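{- For every positive integer $m$, $$\sum_{n=1}^\infty \frac{Y_m(n)}{n}(-1)^{n-1} = m!\,\mathrm{Li}_{m+1}\!\left(\frac12\right).$$
   Context: For positive integers $n,r$, $H_n^{(r)}=\sum_{j=1}^n j^{ -r}$ and $H_n=H_n^{(1)}$. The complete exponential Bell polynomials $Y_k(x_1,x_2,\dots)$ are defined by $\exp\left(\sum_{m\ge1}x_m\frac{t^m}{m!}\right)=1+\sum_{k\ge1}Y_k(x_1,x_2,\dots)\frac{t^k}{k!}$, and $Y_k(n):=Y_k\big(H_n,\,1!H_n^{(2)},\,2!H_n^{(3)},\dots,(r-1)!H_n^{(r)},\dots\big)$. For example $Y_1(n)=H_n$, $Y_2(n)=H_n^2+H_n^{(2)}$, $Y_3(n)=H_n^3+3H_nH_n^{(2)}+2H_n^{(3)}$. $\mathrm{Li}_p(x)=\sum_{n\ge1}x^n/n^p$ is the polylogarithm. -}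

module Defs where

open import Data.Nat as ℕ using (ℕ; zero; suc; _≤ᵇ_; _∸_)
open import Data.Bool using (Bool; true; false)
open import Data.Nat.Combinatorics using (_C_)
open import Data.Integer using (+_)
open import Data.Rational using (ℚ; 0ℚ; 1ℚ; _+_; _*_; _/_; -_)

qpow : ℚ → ℕ → ℚ
qpow q zero    = 1ℚ
qpow q (suc k) = q * qpow q k

toℚ : ℕ → ℚ
toℚ n = (+ n) / 1

Σ₁ : ℕ → (ℕ → ℚ) → ℚ
Σ₁ zero    f = 0ℚ
Σ₁ (suc n) f = Σ₁ n f + f (suc n)

Σ₀ : ℕ → (ℕ → ℚ) → ℚ
Σ₀ zero    f = f 0
Σ₀ (suc n) f = Σ₀ n f + f (suc n)

-- 1 / j^r  (value 0 at j = 0, never used since sums start at 1)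
invPow : ℕ → ℕ → ℚ
invPow zero    r = 0ℚ
invPow (suc i) r = qpow ((+ 1) / suc i) r

H : ℕ → ℕ → ℚ
H r n = Σ₁ n (λ j → invPow j r)

xArg : ℕ → ℕ → ℚ
xArg n zero    = 0ℚ
xArg n (suc r) = toℚ (r ℕ.!) * H (suc r) n

-- Complete exponential Bell polynomials, via the standard recurrence
--   Y_0 = 1,  Y_{k+1} = Σ_{i=0}^{k} C(k,i) x_{i+1} Y_{k-i},
-- tabulated: Ytab x k j = Y_j(x) for all j ≤ k.
mutual
  Ytab : (ℕ → ℚ) → ℕ → ℕ → ℚ
  Ytab x zero    j = 1ℚ
  Ytab x (suc k) j = step x k j (j ≤ᵇ k)

  step : (ℕ → ℚ) → ℕ → ℕ → Bool → ℚ
  step x k j true    = Ytab x k j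
  step x k j false   = Σ₀ k (λ i → toℚ (k C i) * x (suc i) * Ytab x k (k ∸ i))

BellY : (ℕ → ℚ) → ℕ → ℚ
BellY x k = Ytab x k k

Y : ℕ → ℕ → ℚ
Y k n = BellY (xArg n) k

altSign : ℕ → ℚ
altSign zero          = 1ℚ
altSign (suc zero)    = 1ℚ
altSign (suc (suc n)) = altSign (suc n) * (- 1ℚ)

lhsPartial : ℕ → ℕ → ℚ
lhsPartial m K = Σ₁ K (λ n → Y m n * invPow n 1 * altSign n)

liHalfPartial : ℕ → ℕ → ℚ
liHalfPartial p K = Σ₁ K (λ k → qpow ((+ 1) / 2) k * invPow k p)

module Submission where

-- Y_m(n) = m!·h_m(n), where h_m(n) is the complete homogeneous symmetric
--     sum of 1, 1/2, …, 1/n; this follows from the Bell recurrence and Newton's identity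
--     Σ_{i≤k} H_n^{(i+1)} h_{k-i}(n) = (k+1)·h_{k+1}(n).
-- (2) Euler's transformation.  The alternating binomial transform of h_m(i+1)/(i+1) is
--     (K+1)^{-(m+1)}; hence Σ_{i≤K} C(K,i) S_i = 2^K T_K, i.e.
--     S_K - T_K = 2^{-K} Σ_{i≤K} C(K,i) (S_K - S_i).
-- (3) Estimates.  The terms a_n = m! h_m(n)/n decrease, so |S_K - S_i| ≤ a_{i+1} (Leibniz), and
--     splitting the binomial average at L gives |S_K - T_K| ≤ a_{L+1} + m!·2^{-K} Σ_{i<L} C(K,i).
--     As H_{2^k} ≤ k+1, a_{2^k} ≤ m!(k+1)^m/2^k, while Σ_{i<L} C(K,i) ≤ (K+1)^L; since 2^k beats
--     every polynomial, first L and then K can be chosen to make both terms smaller than ε/2.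

module Proof where

  open import Defs
  open import Data.Nat as ℕ using (ℕ; zero; suc)
  import Data.Nat.Properties as ℕP
  import Data.Nat.Solver as ℕSolver
  import Data.Nat.Coprimality as Coprime
  open import Data.Nat.Combinatorics using (_C_; nCk+nC[k+1]≡[n+1]C[k+1]; k>n⇒nCk≡0; nCk≡n!/k![n-k]!; k![n∸k]!∣n!)
  open import Data.Nat.DivMod using (m/n*n≡m)
  import Data.Integer as ℤ
  import Data.Integer.Properties as ℤP
  open import Data.Bool using (true; false)
  import Data.Bool as Bool
  open import Data.Empty using (⊥-elim)
  open import Data.Product using (_×_; _,_; proj₁; proj₂; ∃-syntax)
  open import Data.Sum using (inj₁; inj₂)
  open import Data.Rational
  open import Data.Rational.Properties
  open import Data.Rational.Solver
  open +-*-Solver using (solve; _:+_; _:*_; _:=_; con; :-_; _:-_)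
  open import Relation.Binary.PropositionalEquality
  open import Relation.Nullary using (yes; no)

  -- Both are reduced fractions
  -- already, and in that normal form the cast is visibly a semiring homomorphism and
  -- recip n is visibly the inverse of n+1.

  toℚ-normal : ∀ n → toℚ n ≡ mkℚ (ℤ.+ n) 0 (Coprime.sym (Coprime.1-coprimeTo n))
  toℚ-normal n = ↥p/↧p≡p (mkℚ (ℤ.+ n) 0 (Coprime.sym (Coprime.1-coprimeTo n)))

  toℚ-+ : ∀ a b → toℚ (a ℕ.+ b) ≡ toℚ a + toℚ b
  toℚ-+ a b = sym (trans (cong₂ _+_ (toℚ-normal a) (toℚ-normal b))
    (/-cong (cong₂ ℤ._+_ (ℤP.*-identityʳ (ℤ.+ a)) (ℤP.*-identityʳ (ℤ.+ b))) refl))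

  toℚ-* : ∀ a b → toℚ (a ℕ.* b) ≡ toℚ a * toℚ b
  toℚ-* a b = sym (trans (cong₂ _*_ (toℚ-normal a) (toℚ-normal b)) (/-cong (sym (ℤP.pos-* a b)) refl))

  toℚ-suc : ∀ n → toℚ (suc n) ≡ 1ℚ + toℚ n
  toℚ-suc = toℚ-+ 1

  recip : ℕ → ℚ
  recip n = (ℤ.+ 1) / suc n

  recip-normal : ∀ n → recip n ≡ mkℚ (ℤ.+ 1) n (Coprime.1-coprimeTo (suc n))
  recip-normal n = ↥p/↧p≡p (mkℚ (ℤ.+ 1) n (Coprime.1-coprimeTo (suc n)))

  recip-inverseˡ : ∀ n → recip n * toℚ (suc n) ≡ 1ℚ
  recip-inverseˡ n = trans (cong₂ _*_ (recip-normal n) (toℚ-normal (suc n))) (*-inverseˡ q)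
    where
    q : ℚ
    q = mkℚ (ℤ.+ suc n) 0 (Coprime.sym (Coprime.1-coprimeTo (suc n)))

  recip-inverseʳ : ∀ n → toℚ (suc n) * recip n ≡ 1ℚ
  recip-inverseʳ n = trans (*-comm (toℚ (suc n)) (recip n)) (recip-inverseˡ n)

  *-monoˡ-≤-nonneg : ∀ {r p q} → 0ℚ ≤ r → p ≤ q → r * p ≤ r * q
  *-monoˡ-≤-nonneg {r} r≥0 = *-monoˡ-≤-nonNeg r {{nonNegative r≥0}}

  *-monoʳ-≤-nonneg : ∀ {r p q} → 0ℚ ≤ r → p ≤ q → p * r ≤ q * r
  *-monoʳ-≤-nonneg {r} r≥0 = *-monoʳ-≤-nonNeg r {{nonNegative r≥0}}

  *-nonneg : ∀ {p q} → 0ℚ ≤ p → 0ℚ ≤ q → 0ℚ ≤ p * q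
  *-nonneg {p} p≥0 q≥0 = subst (_≤ p * _) (*-zeroʳ p) (*-monoˡ-≤-nonneg p≥0 q≥0)

  sub-nonneg : ∀ {x z} → z ≤ x → 0ℚ ≤ x - z
  sub-nonneg {x} {z} z≤x = ≤-trans (≤-reflexive (sym (+-inverseʳ x))) (+-monoʳ-≤ x (neg-antimono-≤ z≤x))

  sub-≤ : ∀ {x z} → 0ℚ ≤ z → x - z ≤ x
  sub-≤ {x} {z} z≥0 = ≤-trans (+-monoʳ-≤ x (neg-antimono-≤ z≥0)) (≤-reflexive (+-identityʳ x))

  toℚ-nonneg : ∀ n → 0ℚ ≤ toℚ n
  toℚ-nonneg n = subst (0ℚ ≤_) (sym (toℚ-normal n)) (nonNegative⁻¹ _)

  toℚ-mono : ∀ {a b} → a ℕ.≤ b → toℚ a ≤ toℚ b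
  toℚ-mono {a} {b} a≤b = begin
    toℚ a                      ≡⟨ sym (+-identityʳ (toℚ a)) ⟩
    toℚ a + 0ℚ                 ≤⟨ +-monoʳ-≤ (toℚ a) (toℚ-nonneg (b ℕ.∸ a)) ⟩
    toℚ a + toℚ (b ℕ.∸ a)      ≡⟨ sym (toℚ-+ a (b ℕ.∸ a)) ⟩
    toℚ (a ℕ.+ (b ℕ.∸ a))      ≡⟨ cong toℚ (ℕP.m+[n∸m]≡n a≤b) ⟩
    toℚ b                      ∎
    where open ≤-Reasoning

  toℚ-< : ∀ {a b} → a ℕ.< b → toℚ a < toℚ b
  toℚ-< {a} {b} a<b = begin-strict
    toℚ a          ≡⟨ sym (+-identityˡ (toℚ a)) ⟩
    0ℚ + toℚ a     <⟨ +-monoˡ-< (toℚ a) (positive⁻¹ 1ℚ) ⟩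
    1ℚ + toℚ a     ≡⟨ sym (toℚ-suc a) ⟩
    toℚ (suc a)    ≤⟨ toℚ-mono a<b ⟩
    toℚ b          ∎
    where open ≤-Reasoning

  recip-pos : ∀ n → 0ℚ < recip n
  recip-pos n = subst (0ℚ <_) (sym (recip-normal n)) (positive⁻¹ _)

  recip-nonneg : ∀ n → 0ℚ ≤ recip n
  recip-nonneg n = <⇒≤ (recip-pos n)

  recip-antitone : ∀ {a b} → a ℕ.≤ b → recip b ≤ recip a
  recip-antitone {a} {b} a≤b = begin
    recip b                                  ≡⟨ sym (*-identityʳ (recip b)) ⟩
    recip b * 1ℚ                             ≡⟨ cong (recip b *_) (sym (recip-inverseʳ a)) ⟩
    recip b * (toℚ (suc a) * recip a)        ≡⟨ sym (*-assoc (recip b) (toℚ (suc a)) (recip a)) ⟩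
    (recip b * toℚ (suc a)) * recip a        ≤⟨ *-monoʳ-≤-nonneg (recip-nonneg a)
                                                  (*-monoˡ-≤-nonneg (recip-nonneg b) (toℚ-mono (ℕ.s≤s a≤b))) ⟩
    (recip b * toℚ (suc b)) * recip a        ≡⟨ cong (_* recip a) (recip-inverseˡ b) ⟩
    1ℚ * recip a                             ≡⟨ *-identityˡ (recip a) ⟩
    recip a                                  ∎
    where open ≤-Reasoning

  qpow-nonneg : ∀ {q} k → 0ℚ ≤ q → 0ℚ ≤ qpow q k
  qpow-nonneg zero    _   = nonNegative⁻¹ 1ℚ
  qpow-nonneg (suc k) q≥0 = *-nonneg q≥0 (qpow-nonneg k q≥0)

  qpow-pos : ∀ {q} k → 0ℚ < q → 0ℚ < qpow q k
  qpow-pos zero        _   = positive⁻¹ 1ℚ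
  qpow-pos {q} (suc k) q>0 =
    positive⁻¹ (q * qpow q k) {{pos*pos⇒pos q {{positive q>0}} (qpow q k) {{positive (qpow-pos k q>0)}}}}

  qpow-mono : ∀ {a b} k → 0ℚ ≤ a → a ≤ b → qpow a k ≤ qpow b k
  qpow-mono zero    _   _   = ≤-refl
  qpow-mono {a} {b} (suc k) a≥0 a≤b = ≤-trans (*-monoʳ-≤-nonneg (qpow-nonneg k a≥0) a≤b)
                                              (*-monoˡ-≤-nonneg (≤-trans a≥0 a≤b) (qpow-mono k a≥0 a≤b))

  qpow-toℚ : ∀ x k → qpow (toℚ x) k ≡ toℚ (x ℕ.^ k)
  qpow-toℚ x zero    = refl
  qpow-toℚ x (suc k) = trans (cong (toℚ x *_) (qpow-toℚ x k)) (sym (toℚ-* x (x ℕ.^ k)))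

  Σ₀-cong : ∀ K {f g : ℕ → ℚ} → (∀ i → i ℕ.≤ K → f i ≡ g i) → Σ₀ K f ≡ Σ₀ K g
  Σ₀-cong zero    eq = eq 0 ℕ.z≤n
  Σ₀-cong (suc K) eq = cong₂ _+_ (Σ₀-cong K (λ i i≤K → eq i (ℕP.m≤n⇒m≤1+n i≤K))) (eq (suc K) ℕP.≤-refl)

  Σ₀-+ : ∀ K (f g : ℕ → ℚ) → Σ₀ K (λ i → f i + g i) ≡ Σ₀ K f + Σ₀ K g
  Σ₀-+ zero    f g = refl
  Σ₀-+ (suc K) f g = trans (cong (_+ (f (suc K) + g (suc K))) (Σ₀-+ K f g))
    (solve 4 (λ a b c d → (a :+ b) :+ (c :+ d) := (a :+ c) :+ (b :+ d)) refl
       (Σ₀ K f) (Σ₀ K g) (f (suc K)) (g (suc K)))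

  Σ₀-*ˡ : ∀ K c (f : ℕ → ℚ) → Σ₀ K (λ i → c * f i) ≡ c * Σ₀ K f
  Σ₀-*ˡ zero    c f = refl
  Σ₀-*ˡ (suc K) c f = trans (cong (_+ c * f (suc K)) (Σ₀-*ˡ K c f)) (sym (*-distribˡ-+ c (Σ₀ K f) (f (suc K))))

  Σ₀-neg : ∀ K (f : ℕ → ℚ) → Σ₀ K (λ i → - f i) ≡ - Σ₀ K f
  Σ₀-neg zero    f = refl
  Σ₀-neg (suc K) f = trans (cong (_+ - f (suc K)) (Σ₀-neg K f)) (sym (neg-distrib-+ (Σ₀ K f) (f (suc K))))

  Σ₀-shift : ∀ K (f : ℕ → ℚ) → Σ₀ (suc K) f ≡ f 0 + Σ₀ K (λ i → f (suc i))
  Σ₀-shift zero    f = refl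
  Σ₀-shift (suc K) f = trans (cong (_+ f (suc (suc K))) (Σ₀-shift K f))
    (+-assoc (f 0) (Σ₀ K (λ i → f (suc i))) (f (suc (suc K))))

  Σ₀-drop-last : ∀ K (f : ℕ → ℚ) → f (suc K) ≡ 0ℚ → Σ₀ (suc K) f ≡ Σ₀ K f
  Σ₀-drop-last K f f0 = trans (cong (Σ₀ K f +_) f0) (+-identityʳ (Σ₀ K f))

  Σ₀-mono : ∀ K {f g : ℕ → ℚ} → (∀ i → i ℕ.≤ K → f i ≤ g i) → Σ₀ K f ≤ Σ₀ K g
  Σ₀-mono zero    le = le 0 ℕ.z≤n
  Σ₀-mono (suc K) le = +-mono-≤ (Σ₀-mono K (λ i i≤K → le i (ℕP.m≤n⇒m≤1+n i≤K))) (le (suc K) ℕP.≤-refl)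

  Σ₀-triangle : ∀ K (f : ℕ → ℚ) → ∣ Σ₀ K f ∣ ≤ Σ₀ K (λ i → ∣ f i ∣)
  Σ₀-triangle zero    f = ≤-refl
  Σ₀-triangle (suc K) f = ≤-trans (∣p+q∣≤∣p∣+∣q∣ (Σ₀ K f) (f (suc K))) (+-monoˡ-≤ ∣ f (suc K) ∣ (Σ₀-triangle K f))

  Σ₁-mono : ∀ n {f g : ℕ → ℚ} → (∀ j → 1 ℕ.≤ j → j ℕ.≤ n → f j ≤ g j) → Σ₁ n f ≤ Σ₁ n g
  Σ₁-mono zero    le = ≤-refl
  Σ₁-mono (suc n) le = +-mono-≤ (Σ₁-mono n (λ j 1≤j j≤n → le j 1≤j (ℕP.m≤n⇒m≤1+n j≤n))) (le (suc n) (ℕ.s≤s ℕ.z≤n) ℕP.≤-refl)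

  Σ₁-nonneg : ∀ n {f : ℕ → ℚ} → (∀ j → 1 ℕ.≤ j → 0ℚ ≤ f j) → 0ℚ ≤ Σ₁ n f
  Σ₁-nonneg zero    _  = ≤-refl
  Σ₁-nonneg (suc n) f≥0 = +-mono-≤ (Σ₁-nonneg n f≥0) (f≥0 (suc n) (ℕ.s≤s ℕ.z≤n))

  Σ₁-*ˡ : ∀ n c (f : ℕ → ℚ) → Σ₁ n (λ j → c * f j) ≡ c * Σ₁ n f
  Σ₁-*ˡ zero    c f = sym (*-zeroʳ c)
  Σ₁-*ˡ (suc n) c f = trans (cong (_+ c * f (suc n)) (Σ₁-*ˡ n c f)) (sym (*-distribˡ-+ c (Σ₁ n f) (f (suc n))))

  binom : ℕ → (ℕ → ℚ) → ℚ
  binom K f = Σ₀ K (λ i → toℚ (K C i) * f i)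

  binom-cong : ∀ K {f g : ℕ → ℚ} → (∀ i → i ℕ.≤ K → f i ≡ g i) → binom K f ≡ binom K g
  binom-cong K eq = Σ₀-cong K (λ i i≤K → cong (toℚ (K C i) *_) (eq i i≤K))

  binom-+ : ∀ K (f g : ℕ → ℚ) → binom K (λ i → f i + g i) ≡ binom K f + binom K g
  binom-+ K f g = trans (Σ₀-cong K (λ i _ → *-distribˡ-+ (toℚ (K C i)) (f i) (g i))) (Σ₀-+ K _ _)

  binom-*ˡ : ∀ K c (f : ℕ → ℚ) → binom K (λ i → c * f i) ≡ c * binom K f
  binom-*ˡ K c f = trans (Σ₀-cong K (λ i _ → solve 3 (λ b c x → b :* (c :* x) := c :* (b :* x)) refl (toℚ (K C i)) c (f i)))
                         (Σ₀-*ˡ K c _)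

  binom-neg : ∀ K (f : ℕ → ℚ) → binom K (λ i → - f i) ≡ - binom K f
  binom-neg K f = trans (Σ₀-cong K (λ i _ → sym (neg-distribʳ-* (toℚ (K C i)) (f i)))) (Σ₀-neg K _)

  binom-mono : ∀ K {f g : ℕ → ℚ} → (∀ i → i ℕ.≤ K → f i ≤ g i) → binom K f ≤ binom K g
  binom-mono K le = Σ₀-mono K (λ i i≤K → *-monoˡ-≤-nonneg (toℚ-nonneg (K C i)) (le i i≤K))

  binom-triangle : ∀ K (f : ℕ → ℚ) → ∣ binom K f ∣ ≤ binom K (λ i → ∣ f i ∣)
  binom-triangle K f = ≤-trans (Σ₀-triangle K _) (≤-reflexive (Σ₀-cong K (λ i _ → absorb-abs i)))
    where
    absorb-abs : ∀ i → ∣ toℚ (K C i) * f i ∣ ≡ toℚ (K C i) * ∣ f i ∣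
    absorb-abs i = trans (∣p*q∣≡∣p∣*∣q∣ (toℚ (K C i)) (f i)) (cong (_* ∣ f i ∣) (0≤p⇒∣p∣≡p (toℚ-nonneg (K C i))))

  binomial-factorials : ∀ {k i} → i ℕ.≤ k → (k C i) ℕ.* (i ℕ.! ℕ.* (k ℕ.∸ i) ℕ.!) ≡ k ℕ.!
  binomial-factorials {k} {i} i≤k = trans (cong (ℕ._* (i ℕ.! ℕ.* (k ℕ.∸ i) ℕ.!)) (nCk≡n!/k![n-k]! i≤k))
                                          (m/n*n≡m {{i ℕP.!* (k ℕ.∸ i) !≢0}} (k![n∸k]!∣n! i≤k))

  -- The absorption identity (i+1)·C(K+1, i+1) = (K+1)·C(K, i): both sides times i!(K-i)! equal (K+1)!.
  absorption : ∀ {K i} → i ℕ.≤ K → suc i ℕ.* (suc K C suc i) ≡ suc K ℕ.* (K C i)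
  absorption {K} {i} i≤K = ℕP.*-cancelʳ-≡ _ _ (i ℕ.! ℕ.* (K ℕ.∸ i) ℕ.!) {{i ℕP.!* (K ℕ.∸ i) !≢0}} (begin
    suc i ℕ.* C′ ℕ.* (i ℕ.! ℕ.* (K ℕ.∸ i) ℕ.!)
      ≡⟨ ℕS.solve 4 (λ s c a b → s ℕS.:* c ℕS.:* (a ℕS.:* b) ℕS.:= c ℕS.:* ((s ℕS.:* a) ℕS.:* b)) refl (suc i) C′ (i ℕ.!) ((K ℕ.∸ i) ℕ.!) ⟩
    C′ ℕ.* (suc i ℕ.! ℕ.* (K ℕ.∸ i) ℕ.!)            ≡⟨ binomial-factorials (ℕ.s≤s i≤K) ⟩
    suc K ℕ.* K ℕ.!                                 ≡⟨ cong (suc K ℕ.*_) (sym (binomial-factorials i≤K)) ⟩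
    suc K ℕ.* ((K C i) ℕ.* (i ℕ.! ℕ.* (K ℕ.∸ i) ℕ.!)) ≡⟨ sym (ℕP.*-assoc (suc K) (K C i) _) ⟩
    suc K ℕ.* (K C i) ℕ.* (i ℕ.! ℕ.* (K ℕ.∸ i) ℕ.!) ∎)
    where
    open ≡-Reasoning
    module ℕS = ℕSolver.+-*-Solver
    C′ : ℕ
    C′ = suc K C suc i

  -- Writing binom K f as f 0 plus the shifted terms C(K, i+1) f(i+1), i ≤ K
  -- (the last of which vanishes since C(K, K+1) = 0).
  binom-peel : ∀ K (f : ℕ → ℚ) → binom K f ≡ f 0 + Σ₀ K (λ i → toℚ (K C suc i) * f (suc i))
  binom-peel zero    f = trans (*-identityˡ (f 0)) (sym (trans (cong (f 0 +_) (*-zeroˡ (f 1))) (+-identityʳ (f 0))))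
  binom-peel (suc K) f = begin
    binom (suc K) f                                                    ≡⟨ Σ₀-shift K _ ⟩
    1ℚ * f 0 + Σ₀ K (λ i → toℚ (suc K C suc i) * f (suc i))
      ≡⟨ cong (_+ Σ₀ K (λ i → toℚ (suc K C suc i) * f (suc i))) (*-identityˡ (f 0)) ⟩
    f 0 + Σ₀ K (λ i → toℚ (suc K C suc i) * f (suc i))                 ≡⟨ cong (f 0 +_) (sym (Σ₀-drop-last K _ last-vanishes)) ⟩
    f 0 + Σ₀ (suc K) (λ i → toℚ (suc K C suc i) * f (suc i))           ∎
    where
    open ≡-Reasoning
    last-vanishes : toℚ (suc K C suc (suc K)) * f (suc (suc K)) ≡ 0ℚ
    last-vanishes = trans (cong (λ c → toℚ c * f (suc (suc K))) (k>n⇒nCk≡0 (ℕP.n<1+n (suc K)))) (*-zeroˡ (f (suc (suc K))))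

  -- Pascal's rule C(K+1, i+1) = C(K, i) + C(K, i+1), summed against f.
  binom-pascal : ∀ K (f : ℕ → ℚ) → binom (suc K) f ≡ binom K f + binom K (λ i → f (suc i))
  binom-pascal K f = begin
    binom (suc K) f                                       ≡⟨ binom-peel (suc K) f ⟩
    f 0 + Σ₀ (suc K) (λ i → toℚ (suc K C suc i) * g i)
      ≡⟨ cong (f 0 +_) (trans (Σ₀-cong (suc K) (λ i _ → pascal i)) (Σ₀-+ (suc K) _ _)) ⟩
    f 0 + (Σ₀ (suc K) (λ i → toℚ (K C i) * g i) + Σ₀ (suc K) (λ i → toℚ (K C suc i) * g i))
      ≡⟨ cong₂ (λ x y → f 0 + (x + y)) (Σ₀-drop-last K _ (vanishes (ℕP.n<1+n K)))
                                        (Σ₀-drop-last K _ (vanishes (ℕP.m<n⇒m<1+n (ℕP.n<1+n K)))) ⟩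
    f 0 + (binom K g + Σ₀ K (λ i → toℚ (K C suc i) * g i))
      ≡⟨ solve 3 (λ a b c → a :+ (b :+ c) := (a :+ c) :+ b) refl (f 0) (binom K g) _ ⟩
    (f 0 + Σ₀ K (λ i → toℚ (K C suc i) * g i)) + binom K g ≡⟨ cong (_+ binom K g) (sym (binom-peel K f)) ⟩
    binom K f + binom K g                                 ∎
    where
    open ≡-Reasoning
    g : ℕ → ℚ
    g i = f (suc i)
    pascal : ∀ i → toℚ (suc K C suc i) * g i ≡ toℚ (K C i) * g i + toℚ (K C suc i) * g i
    pascal i = trans (cong (λ c → toℚ c * g i) (sym (nCk+nC[k+1]≡[n+1]C[k+1] K i)))
                     (trans (cong (_* g i) (toℚ-+ (K C i) (K C suc i))) (*-distribʳ-+ (g i) (toℚ (K C i)) (toℚ (K C suc i))))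
    vanishes : ∀ {c} → K ℕ.< c → toℚ (K C c) * g (suc K) ≡ 0ℚ
    vanishes K<c = trans (cong (λ c → toℚ c * g (suc K)) (k>n⇒nCk≡0 K<c)) (*-zeroˡ (g (suc K)))

  pow2 : ℕ → ℚ
  pow2 K = qpow (toℚ 2) K

  binom-ones : ∀ K → binom K (λ _ → 1ℚ) ≡ pow2 K
  binom-ones zero    = refl
  binom-ones (suc K) = begin
    binom (suc K) (λ _ → 1ℚ)     ≡⟨ binom-pascal K (λ _ → 1ℚ) ⟩
    binom K _ + binom K _        ≡⟨ cong₂ _+_ (binom-ones K) (binom-ones K) ⟩
    pow2 K + pow2 K              ≡⟨ solve 1 (λ x → x :+ x := (con 1ℚ :+ con 1ℚ) :* x) refl (pow2 K) ⟩
    (1ℚ + 1ℚ) * pow2 K           ≡⟨ cong (_* pow2 K) (sym (toℚ-suc 1)) ⟩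
    pow2 (suc K)                 ∎
    where open ≡-Reasoning

  half : ℚ
  half = recip 1

  pow2-half : ∀ K → pow2 K * qpow half K ≡ 1ℚ
  pow2-half zero    = refl
  pow2-half (suc K) = begin
    (toℚ 2 * pow2 K) * (half * qpow half K)
      ≡⟨ solve 4 (λ a b c d → (a :* b) :* (c :* d) := (a :* c) :* (b :* d)) refl (toℚ 2) (pow2 K) half (qpow half K) ⟩
    (toℚ 2 * half) * (pow2 K * qpow half K)   ≡⟨ cong₂ _*_ (recip-inverseʳ 1) (pow2-half K) ⟩
    1ℚ                                         ∎
    where open ≡-Reasoning

  -- (1) Bell polynomials.  Unfolding the tabulated definition: the table for k contains
  -- Y_j for every j ≤ k, so Y_{k+1} obeys the recurrence stated in Defs.

  Ytab-stable : ∀ x k j → j ℕ.≤ k → Ytab x k j ≡ BellY x j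
  Ytab-stable x zero    zero _ = refl
  Ytab-stable x (suc k) j j≤k+1 with ℕP.m≤n⇒m<n∨m≡n j≤k+1
  ... | inj₂ refl = refl
  ... | inj₁ j<k+1 with j ℕ.≤ᵇ k in eq
  ...   | true  = Ytab-stable x k j (ℕP.≤-pred j<k+1)
  ...   | false = ⊥-elim (subst Bool.T eq (ℕP.≤⇒≤ᵇ (ℕP.≤-pred j<k+1)))

  BellY-rec : ∀ x k → BellY x (suc k) ≡ Σ₀ k (λ i → toℚ (k C i) * x (suc i) * BellY x (k ℕ.∸ i))
  BellY-rec x k with suc k ℕ.≤ᵇ k in eq
  ... | true  = ⊥-elim (ℕP.<-irrefl refl (ℕP.≤ᵇ⇒≤ (suc k) k (subst Bool.T (sym eq) _)))
  ... | false = Σ₀-cong k (λ i _ → cong (toℚ (k C i) * x (suc i) *_) (Ytab-stable x k (k ℕ.∸ i) (ℕP.m∸n≤m k i)))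

  -- The nested harmonic sums  h_0(n) = 1,  h_{m+1}(n) = Σ_{j ≤ n} h_m(j)/j,
  -- i.e. the complete homogeneous symmetric polynomials in 1, 1/2, …, 1/n.
  hsum : ℕ → ℕ → ℚ
  hsum zero    n = 1ℚ
  hsum (suc m) n = Σ₁ n (λ j → hsum m j * invPow j 1)

  -- Adding the variable u = 1/(n+1):  h_k(n+1) = Σ_{i ≤ k} u^i h_{k-i}(n).
  hsum-expand : ∀ n k → hsum k (suc n) ≡ Σ₀ k (λ i → qpow (recip n) i * hsum (k ℕ.∸ i) n)
  hsum-expand n zero    = sym (*-identityˡ 1ℚ)
  hsum-expand n (suc k) = begin
    hsum (suc k) n + hsum k (suc n) * (u * 1ℚ)   ≡⟨ cong (λ z → hsum (suc k) n + z * (u * 1ℚ)) (hsum-expand n k) ⟩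
    hsum (suc k) n + S * (u * 1ℚ)
      ≡⟨ solve 3 (λ a s u → a :+ s :* (u :* con 1ℚ) := con 1ℚ :* a :+ u :* s) refl (hsum (suc k) n) S u ⟩
    1ℚ * hsum (suc k) n + u * S                  ≡⟨ cong (1ℚ * hsum (suc k) n +_) (sym (Σ₀-*ˡ k u _)) ⟩
    1ℚ * hsum (suc k) n + Σ₀ k (λ i → u * (qpow u i * hsum (k ℕ.∸ i) n))
      ≡⟨ cong (1ℚ * hsum (suc k) n +_) (Σ₀-cong k (λ i _ → sym (*-assoc u (qpow u i) (hsum (k ℕ.∸ i) n)))) ⟩
    1ℚ * hsum (suc k) n + Σ₀ k (λ i → qpow u (suc i) * hsum (k ℕ.∸ i) n) ≡⟨ sym (Σ₀-shift k _) ⟩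
    Σ₀ (suc k) (λ i → qpow u i * hsum (suc k ℕ.∸ i) n) ∎
    where
    open ≡-Reasoning
    u S : ℚ
    u = recip n
    S = Σ₀ k (λ i → qpow u i * hsum (k ℕ.∸ i) n)

  conv : (ℕ → ℚ) → (ℕ → ℚ) → ℕ → ℚ
  conv p q k = Σ₀ k (λ i → p (suc i) * q (k ℕ.∸ i))

  conv-+ˡ : ∀ (p p′ q : ℕ → ℚ) k → conv (λ r → p r + p′ r) q k ≡ conv p q k + conv p′ q k
  conv-+ˡ p p′ q k = trans (Σ₀-cong k (λ i _ → *-distribʳ-+ (q (k ℕ.∸ i)) (p (suc i)) (p′ (suc i)))) (Σ₀-+ k _ _)

  conv-split : ∀ (p q q′ r : ℕ → ℚ) c k → q 0 ≡ q′ 0 → (∀ j → q (suc j) ≡ q′ (suc j) + c * r j) →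
               conv p q (suc k) ≡ conv p q′ (suc k) + c * conv p r k
  conv-split p q q′ r c k q0 qs = begin
    Σ₀ k (λ i → p (suc i) * q (suc k ℕ.∸ i)) + p (suc (suc k)) * q (k ℕ.∸ k)
      ≡⟨ cong₂ _+_ (Σ₀-cong k (λ i i≤k → termwise i i≤k)) (cong (λ j → p (suc (suc k)) * q j) (ℕP.n∸n≡0 k)) ⟩
    Σ₀ k (λ i → p (suc i) * q′ (suc k ℕ.∸ i) + c * (p (suc i) * r (k ℕ.∸ i))) + p (suc (suc k)) * q 0
      ≡⟨ cong₂ _+_ (trans (Σ₀-+ k _ _) (cong (Σ₀ k (λ i → p (suc i) * q′ (suc k ℕ.∸ i)) +_) (Σ₀-*ˡ k c _)))
                   (cong (λ z → p (suc (suc k)) * z) (trans q0 (cong q′ (sym (ℕP.n∸n≡0 k))))) ⟩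
    (A + c * conv p r k) + p (suc (suc k)) * q′ (k ℕ.∸ k)
      ≡⟨ solve 3 (λ a b l → (a :+ b) :+ l := (a :+ l) :+ b) refl A (c * conv p r k) _ ⟩
    conv p q′ (suc k) + c * conv p r k ∎
    where
    open ≡-Reasoning
    A : ℚ
    A = Σ₀ k (λ i → p (suc i) * q′ (suc k ℕ.∸ i))
    termwise : ∀ i → i ℕ.≤ k → p (suc i) * q (suc k ℕ.∸ i) ≡ p (suc i) * q′ (suc k ℕ.∸ i) + c * (p (suc i) * r (k ℕ.∸ i))
    termwise i i≤k = begin
      p (suc i) * q (suc k ℕ.∸ i)                          ≡⟨ cong (λ j → p (suc i) * q j) (ℕP.+-∸-assoc 1 i≤k) ⟩
      p (suc i) * q (suc (k ℕ.∸ i))                        ≡⟨ cong (p (suc i) *_) (qs (k ℕ.∸ i)) ⟩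
      p (suc i) * (q′ (suc (k ℕ.∸ i)) + c * r (k ℕ.∸ i))
        ≡⟨ solve 4 (λ a b c d → a :* (b :+ c :* d) := a :* b :+ c :* (a :* d)) refl (p (suc i)) _ c (r (k ℕ.∸ i)) ⟩
      p (suc i) * q′ (suc (k ℕ.∸ i)) + c * (p (suc i) * r (k ℕ.∸ i))
        ≡⟨ cong (λ j → p (suc i) * q′ j + c * (p (suc i) * r (k ℕ.∸ i))) (sym (ℕP.+-∸-assoc 1 i≤k)) ⟩
      p (suc i) * q′ (suc k ℕ.∸ i) + c * (p (suc i) * r (k ℕ.∸ i)) ∎

  hsum-one : ∀ n → hsum 1 n ≡ H 1 n
  hsum-one zero    = refl
  hsum-one (suc n) = cong₂ _+_ (hsum-one n) (*-identityˡ (invPow (suc n) 1))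

  conv-powers : ∀ n k → conv (qpow (recip n)) (λ j → hsum j n) k ≡ recip n * hsum k (suc n)
  conv-powers n k = begin
    Σ₀ k (λ i → (u * qpow u i) * hsum (k ℕ.∸ i) n)  ≡⟨ Σ₀-cong k (λ i _ → *-assoc u (qpow u i) (hsum (k ℕ.∸ i) n)) ⟩
    Σ₀ k (λ i → u * (qpow u i * hsum (k ℕ.∸ i) n))  ≡⟨ Σ₀-*ˡ k u _ ⟩
    u * Σ₀ k (λ i → qpow u i * hsum (k ℕ.∸ i) n)    ≡⟨ cong (u *_) (sym (hsum-expand n k)) ⟩
    u * hsum k (suc n)                               ∎
    where
    open ≡-Reasoning
    u : ℚ
    u = recip n

  newton : ∀ n k → conv (λ r → H r n) (λ j → hsum j n) k ≡ toℚ (suc k) * hsum (suc k) n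
  newton zero    k       = trans (Σ₀-cong k (λ i _ → *-zeroˡ (hsum (k ℕ.∸ i) 0)))
                                 (trans (Σ₀-*ˡ k 0ℚ (λ _ → 0ℚ)) (trans (*-zeroˡ (Σ₀ k (λ _ → 0ℚ))) (sym (*-zeroʳ (toℚ (suc k))))))
  newton (suc n) zero    = trans (*-identityʳ (H 1 (suc n))) (sym (trans (*-identityˡ (hsum 1 (suc n))) (hsum-one (suc n))))
  newton (suc n) (suc k) = begin
    conv P′ h′ (suc k)
      ≡⟨ conv-split P′ h′ h h′ c k refl (λ j → cong (h (suc j) +_) (*-comm (hsum j (suc n)) c)) ⟩
    conv P′ h (suc k) + c * conv P′ h′ k
      ≡⟨ cong₂ (λ x y → x + c * y) (conv-+ˡ P (qpow u) h (suc k)) (newton (suc n) k) ⟩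
    (conv P h (suc k) + conv (qpow u) h (suc k)) + c * (toℚ (suc k) * h′ (suc k))
      ≡⟨ cong₂ (λ x y → (x + y) + c * (toℚ (suc k) * h′ (suc k))) (newton n (suc k)) (conv-powers n (suc k)) ⟩
    (toℚ (suc (suc k)) * h (suc (suc k)) + u * h′ (suc k)) + c * (toℚ (suc k) * h′ (suc k))
      ≡⟨ cong (λ t → (t * h (suc (suc k)) + u * h′ (suc k)) + c * (toℚ (suc k) * h′ (suc k))) (toℚ-suc (suc k)) ⟩
    ((1ℚ + toℚ (suc k)) * h (suc (suc k)) + u * h′ (suc k)) + (u * 1ℚ) * (toℚ (suc k) * h′ (suc k))
      ≡⟨ solve 4 (λ t a b u → ((con 1ℚ :+ t) :* a :+ u :* b) :+ (u :* con 1ℚ) :* (t :* b)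
                              := (con 1ℚ :+ t) :* (a :+ b :* (u :* con 1ℚ))) refl (toℚ (suc k)) (h (suc (suc k))) (h′ (suc k)) u ⟩
    (1ℚ + toℚ (suc k)) * h′ (suc (suc k))                     ≡⟨ cong (_* h′ (suc (suc k))) (sym (toℚ-suc (suc k))) ⟩
    toℚ (suc (suc k)) * h′ (suc (suc k))                      ∎
    where
    open ≡-Reasoning
    u c : ℚ
    u = recip n
    c = invPow (suc n) 1
    P P′ h h′ : ℕ → ℚ
    P r  = H r n
    P′ r = H r (suc n)
    h j  = hsum j n
    h′ j = hsum j (suc n)

  -- Y_j(n) = j! h_j(n) for all j ≤ k, by strong induction through the Bell recurrence
  -- and Newton's identity.
  Y-upto : ∀ n k j → j ℕ.≤ k → BellY (xArg n) j ≡ toℚ (j ℕ.!) * hsum j n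
  Y-upto n zero    zero _ = refl
  Y-upto n (suc k) j j≤k+1 with ℕP.m≤n⇒m<n∨m≡n j≤k+1
  ... | inj₁ j<k+1 = Y-upto n k j (ℕP.≤-pred j<k+1)
  ... | inj₂ refl  = begin
    BellY (xArg n) (suc k)                                        ≡⟨ BellY-rec (xArg n) k ⟩
    Σ₀ k (λ i → toℚ (k C i) * xArg n (suc i) * BellY (xArg n) (k ℕ.∸ i))
      ≡⟨ Σ₀-cong k term ⟩
    Σ₀ k (λ i → toℚ (k ℕ.!) * (H (suc i) n * hsum (k ℕ.∸ i) n))  ≡⟨ Σ₀-*ˡ k (toℚ (k ℕ.!)) _ ⟩
    toℚ (k ℕ.!) * conv (λ r → H r n) (λ j → hsum j n) k           ≡⟨ cong (toℚ (k ℕ.!) *_) (newton n k) ⟩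
    toℚ (k ℕ.!) * (toℚ (suc k) * hsum (suc k) n)                  ≡⟨ sym (*-assoc (toℚ (k ℕ.!)) _ _) ⟩
    (toℚ (k ℕ.!) * toℚ (suc k)) * hsum (suc k) n                  ≡⟨ cong (_* hsum (suc k) n) (sym (toℚ-* (k ℕ.!) (suc k))) ⟩
    toℚ (k ℕ.! ℕ.* suc k) * hsum (suc k) n
      ≡⟨ cong (λ z → toℚ z * hsum (suc k) n) (ℕP.*-comm (k ℕ.!) (suc k)) ⟩
    toℚ (suc k ℕ.!) * hsum (suc k) n                              ∎
    where
    open ≡-Reasoning
    term : ∀ i → i ℕ.≤ k → toℚ (k C i) * xArg n (suc i) * BellY (xArg n) (k ℕ.∸ i)
                           ≡ toℚ (k ℕ.!) * (H (suc i) n * hsum (k ℕ.∸ i) n)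
    term i i≤k = begin
      toℚ (k C i) * (toℚ (i ℕ.!) * H (suc i) n) * BellY (xArg n) (k ℕ.∸ i)
        ≡⟨ cong (toℚ (k C i) * (toℚ (i ℕ.!) * H (suc i) n) *_) (Y-upto n k (k ℕ.∸ i) (ℕP.m∸n≤m k i)) ⟩
      toℚ (k C i) * (toℚ (i ℕ.!) * H (suc i) n) * (toℚ ((k ℕ.∸ i) ℕ.!) * hsum (k ℕ.∸ i) n)
        ≡⟨ solve 5 (λ c a p b x → c :* (a :* p) :* (b :* x) := (c :* (a :* b)) :* (p :* x)) refl
             (toℚ (k C i)) (toℚ (i ℕ.!)) (H (suc i) n) (toℚ ((k ℕ.∸ i) ℕ.!)) (hsum (k ℕ.∸ i) n) ⟩
      (toℚ (k C i) * (toℚ (i ℕ.!) * toℚ ((k ℕ.∸ i) ℕ.!))) * (H (suc i) n * hsum (k ℕ.∸ i) n)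
        ≡⟨ cong (_* (H (suc i) n * hsum (k ℕ.∸ i) n)) factorials ⟩
      toℚ (k ℕ.!) * (H (suc i) n * hsum (k ℕ.∸ i) n) ∎
      where
      factorials : toℚ (k C i) * (toℚ (i ℕ.!) * toℚ ((k ℕ.∸ i) ℕ.!)) ≡ toℚ (k ℕ.!)
      factorials = trans (cong (toℚ (k C i) *_) (sym (toℚ-* (i ℕ.!) ((k ℕ.∸ i) ℕ.!))))
                         (trans (sym (toℚ-* (k C i) _)) (cong toℚ (binomial-factorials i≤k)))

  Y-hsum : ∀ m n → Y m n ≡ toℚ (m ℕ.!) * hsum m n
  Y-hsum m n = Y-upto n m m ℕP.≤-refl

  sgn : ℕ → ℚ
  sgn i = altSign (suc i)

  Δ : ℕ → (ℕ → ℚ) → ℚ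
  Δ K u = binom K (λ i → sgn i * u i)

  Δ-step : ∀ K (u : ℕ → ℚ) → Δ (suc K) u ≡ Δ K u - Δ K (λ i → u (suc i))
  Δ-step K u = trans (binom-pascal K (λ i → sgn i * u i)) (cong (Δ K u +_) (begin
    binom K (λ i → (sgn i * (- 1ℚ)) * u (suc i))
      ≡⟨ binom-cong K (λ i _ → solve 2 (λ s x → (s :* (:- con 1ℚ)) :* x := :- (s :* x)) refl (sgn i) (u (suc i))) ⟩
    binom K (λ i → - (sgn i * u (suc i)))         ≡⟨ binom-neg K _ ⟩
    - Δ K (λ i → u (suc i))                        ∎))
    where open ≡-Reasoning

  Δ-difference : ∀ K (u : ℕ → ℚ) → Δ K (λ i → u (suc i) - u i) ≡ - Δ (suc K) u
  Δ-difference K u = begin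
    Δ K (λ i → u (suc i) - u i)                    ≡⟨ binom-cong K (λ i _ → *-distribˡ-+ (sgn i) (u (suc i)) (- u i)) ⟩
    binom K (λ i → sgn i * u (suc i) + sgn i * - u i) ≡⟨ binom-+ K _ _ ⟩
    Δ K (λ i → u (suc i)) + Δ K (λ i → - u i)
      ≡⟨ cong (Δ K (λ i → u (suc i)) +_) (trans (binom-cong K (λ i _ → sym (neg-distribʳ-* (sgn i) (u i)))) (binom-neg K _)) ⟩
    Δ K (λ i → u (suc i)) - Δ K u
      ≡⟨ solve 2 (λ a b → a :- b := :- (b :- a)) refl (Δ K (λ i → u (suc i))) (Δ K u) ⟩
    - (Δ K u - Δ K (λ i → u (suc i)))              ≡⟨ cong -_ (sym (Δ-step K u)) ⟩
    - Δ (suc K) u                                  ∎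
    where open ≡-Reasoning

  absorption-recip : ∀ {K i} → i ℕ.≤ K → toℚ (K C i) * recip i ≡ recip K * toℚ (suc K C suc i)
  absorption-recip {K} {i} i≤K = begin
    toℚ c * recip i                               ≡⟨ cong (_* recip i) (sym (*-identityˡ (toℚ c))) ⟩
    1ℚ * toℚ c * recip i                          ≡⟨ cong (λ z → z * toℚ c * recip i) (sym (recip-inverseˡ K)) ⟩
    recip K * toℚ (suc K) * toℚ c * recip i
      ≡⟨ cong (λ z → z * recip i) (trans (*-assoc (recip K) _ _) (cong (recip K *_) (sym (toℚ-* (suc K) c)))) ⟩
    recip K * toℚ (suc K ℕ.* c) * recip i         ≡⟨ cong (λ z → recip K * toℚ z * recip i) (sym (absorption i≤K)) ⟩
    recip K * toℚ (suc i ℕ.* c′) * recip i        ≡⟨ cong (λ z → recip K * z * recip i) (toℚ-* (suc i) c′) ⟩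
    recip K * (toℚ (suc i) * toℚ c′) * recip i
      ≡⟨ solve 4 (λ r s c t → r :* (s :* c) :* t := r :* c :* (s :* t)) refl (recip K) (toℚ (suc i)) (toℚ c′) (recip i) ⟩
    recip K * toℚ c′ * (toℚ (suc i) * recip i)    ≡⟨ trans (cong (recip K * toℚ c′ *_) (recip-inverseʳ i)) (*-identityʳ _) ⟩
    recip K * toℚ c′                              ∎
    where
    open ≡-Reasoning
    c c′ : ℕ
    c  = K C i
    c′ = suc K C suc i

  Δ-peel : ∀ K (w : ℕ → ℚ) → Σ₀ K (λ i → toℚ (suc K C suc i) * (sgn i * w (suc i))) ≡ w 0 - Δ (suc K) w
  Δ-peel K w = begin
    U                                              ≡⟨ solve 2 (λ w0 t → t := w0 :- (w0 :+ :- t)) refl (w 0) U ⟩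
    w 0 - (w 0 + - U)                              ≡⟨ cong (λ z → w 0 - (w 0 + z)) (sym (Σ₀-neg K _)) ⟩
    w 0 - (w 0 + Σ₀ K (λ i → - (toℚ (suc K C suc i) * (sgn i * w (suc i)))))
      ≡⟨ cong₂ (λ x y → w 0 - (x + y)) (sym (trans (*-identityˡ _) (*-identityˡ (w 0))))
               (Σ₀-cong K (λ i _ → solve 3 (λ c s x → :- (c :* (s :* x)) := c :* ((s :* (:- con 1ℚ)) :* x)) refl (toℚ (suc K C suc i)) (sgn i) (w (suc i)))) ⟩
    w 0 - (1ℚ * (1ℚ * w 0) + Σ₀ K (λ i → toℚ (suc K C suc i) * (sgn (suc i) * w (suc i))))
      ≡⟨ cong (λ z → w 0 - z) (sym (Σ₀-shift K _)) ⟩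
    w 0 - Δ (suc K) w                              ∎
    where
    open ≡-Reasoning
    U : ℚ
    U = Σ₀ K (λ i → toℚ (suc K C suc i) * (sgn i * w (suc i)))

  Δ-divide : ∀ K (w : ℕ → ℚ) → Δ K (λ i → w (suc i) * invPow (suc i) 1) ≡ recip K * (w 0 - Δ (suc K) w)
  Δ-divide K w = begin
    Δ K (λ i → w (suc i) * invPow (suc i) 1)                       ≡⟨ Σ₀-cong K term ⟩
    Σ₀ K (λ i → recip K * (toℚ (suc K C suc i) * (sgn i * w (suc i)))) ≡⟨ Σ₀-*ˡ K (recip K) _ ⟩
    recip K * Σ₀ K (λ i → toℚ (suc K C suc i) * (sgn i * w (suc i))) ≡⟨ cong (recip K *_) (Δ-peel K w) ⟩
    recip K * (w 0 - Δ (suc K) w)                                  ∎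
    where
    open ≡-Reasoning
    term : ∀ i → i ℕ.≤ K → toℚ (K C i) * (sgn i * (w (suc i) * invPow (suc i) 1))
                           ≡ recip K * (toℚ (suc K C suc i) * (sgn i * w (suc i)))
    term i i≤K = begin
      toℚ (K C i) * (sgn i * (w (suc i) * (recip i * 1ℚ)))
        ≡⟨ solve 4 (λ c s x r → c :* (s :* (x :* (r :* con 1ℚ))) := (c :* r) :* (s :* x)) refl (toℚ (K C i)) (sgn i) (w (suc i)) (recip i) ⟩
      (toℚ (K C i) * recip i) * (sgn i * w (suc i))                 ≡⟨ cong (_* (sgn i * w (suc i))) (absorption-recip i≤K) ⟩
      (recip K * toℚ (suc K C suc i)) * (sgn i * w (suc i))         ≡⟨ *-assoc (recip K) _ _ ⟩
      recip K * (toℚ (suc K C suc i) * (sgn i * w (suc i)))         ∎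

  Δ-hsum : ∀ m K → Δ K (λ i → hsum m (suc i) * invPow (suc i) 1) ≡ invPow (suc K) (suc m)
  Δ-hsum zero    K = begin
    Δ K (λ i → 1ℚ * invPow (suc i) 1)             ≡⟨ Δ-divide K (λ _ → 1ℚ) ⟩
    recip K * (1ℚ - Δ (suc K) (λ _ → 1ℚ))         ≡⟨ cong (λ z → recip K * (1ℚ - z)) constant ⟩
    recip K * (1ℚ - 0ℚ)                           ≡⟨ refl ⟩
    invPow (suc K) 1                              ∎
    where
    open ≡-Reasoning
    constant : Δ (suc K) (λ _ → 1ℚ) ≡ 0ℚ
    constant = trans (Δ-step K (λ _ → 1ℚ)) (+-inverseʳ (Δ K (λ _ → 1ℚ)))
  Δ-hsum (suc m) K = begin
    Δ K (λ i → w (suc i) * invPow (suc i) 1)      ≡⟨ Δ-divide K w ⟩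
    recip K * (0ℚ - Δ (suc K) w)                  ≡⟨ cong (recip K *_) (trans (+-identityˡ _) (sym (Δ-difference K w))) ⟩
    recip K * Δ K (λ i → w (suc i) - w i)         ≡⟨ cong (recip K *_) (binom-cong K (λ i _ → cong (sgn i *_) (increment i))) ⟩
    recip K * Δ K (λ i → hsum m (suc i) * invPow (suc i) 1) ≡⟨ cong (recip K *_) (Δ-hsum m K) ⟩
    invPow (suc K) (suc (suc m))                  ∎
    where
    open ≡-Reasoning
    w : ℕ → ℚ
    w = hsum (suc m)
    increment : ∀ i → w (suc i) - w i ≡ hsum m (suc i) * invPow (suc i) 1
    increment i = solve 2 (λ x y → (x :+ y) :- x := y) refl (w i) (hsum m (suc i) * invPow (suc i) 1)

  S : ℕ → ℕ → ℚ
  S m K = lhsPartial m K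

  a : ℕ → ℕ → ℚ
  a m n = toℚ (m ℕ.!) * (hsum m n * invPow n 1)

  T : ℕ → ℕ → ℚ
  T m K = toℚ (m ℕ.!) * liHalfPartial (suc m) K

  series-term : ∀ m n → Y m n * invPow n 1 * altSign n ≡ a m n * altSign n
  series-term m n = trans (cong (λ y → y * invPow n 1 * altSign n) (Y-hsum m n))
    (solve 4 (λ f h v s → f :* h :* v :* s := f :* (h :* v) :* s) refl (toℚ (m ℕ.!)) (hsum m n) (invPow n 1) (altSign n))

  S-step : ∀ m i → S m (suc i) ≡ S m i + a m (suc i) * altSign (suc i)
  S-step m i = cong (S m i +_) (series-term m (suc i))

  euler-transform : ∀ m K → binom K (S m) ≡ pow2 K * T m K
  euler-transform m zero    = sym (trans (*-identityˡ (T m 0)) (*-zeroʳ (toℚ (m ℕ.!))))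
  euler-transform m (suc K) = begin
    binom (suc K) (S m)                                     ≡⟨ binom-pascal K (S m) ⟩
    binom K (S m) + binom K (λ i → S m i + t i)             ≡⟨ cong (binom K (S m) +_) (binom-+ K (S m) t) ⟩
    binom K (S m) + (binom K (S m) + binom K t)             ≡⟨ cong₂ (λ x y → x + (x + y)) (euler-transform m K) new-terms ⟩
    pow2 K * T m K + (pow2 K * T m K + M * v)               ≡⟨ sym T-step ⟩
    pow2 (suc K) * T m (suc K)                              ∎
    where
    open ≡-Reasoning
    M v : ℚ
    M = toℚ (m ℕ.!)
    v = invPow (suc K) (suc m)
    t : ℕ → ℚ
    t i = Y m (suc i) * invPow (suc i) 1 * altSign (suc i)
    new-terms : binom K t ≡ M * v
    new-terms = begin
      binom K t
        ≡⟨ binom-cong K (λ i _ → trans (series-term m (suc i))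
             (solve 4 (λ f h r s → f :* (h :* r) :* s := f :* (s :* (h :* r))) refl M (hsum m (suc i)) (invPow (suc i) 1) (sgn i))) ⟩
      binom K (λ i → M * (sgn i * (hsum m (suc i) * invPow (suc i) 1))) ≡⟨ binom-*ˡ K M _ ⟩
      M * Δ K (λ i → hsum m (suc i) * invPow (suc i) 1)                 ≡⟨ cong (M *_) (Δ-hsum m K) ⟩
      M * v                                                             ∎
    T-step : pow2 (suc K) * T m (suc K) ≡ pow2 K * T m K + (pow2 K * T m K + M * v)
    T-step = begin
      (two * pow2 K) * (M * (Li + (half * qpow half K) * v))
        ≡⟨ solve 7 (λ t P M Li h q v → (t :* P) :* (M :* (Li :+ (h :* q) :* v)) := t :* (P :* (M :* Li)) :+ (M :* v) :* ((t :* h) :* (P :* q)))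
             refl two (pow2 K) M Li half (qpow half K) v ⟩
      two * (pow2 K * T m K) + (M * v) * ((two * half) * (pow2 K * qpow half K))
        ≡⟨ cong₂ (λ x y → x * (pow2 K * T m K) + (M * v) * y) (toℚ-suc 1) (cong₂ _*_ (recip-inverseʳ 1) (pow2-half K)) ⟩
      (1ℚ + 1ℚ) * (pow2 K * T m K) + (M * v) * (1ℚ * 1ℚ)
        ≡⟨ solve 2 (λ x y → (con 1ℚ :+ con 1ℚ) :* x :+ y :* (con 1ℚ :* con 1ℚ) := x :+ (x :+ y)) refl (pow2 K * T m K) (M * v) ⟩
      pow2 K * T m K + (pow2 K * T m K + M * v) ∎
      where
      two Li : ℚ
      two = toℚ 2
      Li  = liHalfPartial (suc m) K

  euler-difference : ∀ m K → pow2 K * (S m K - T m K) ≡ binom K (λ i → S m K - S m i)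
  euler-difference m K = sym (begin
    binom K (λ i → S m K - S m i)
      ≡⟨ binom-cong K (λ i _ → solve 2 (λ x y → x :- y := x :* con 1ℚ :+ :- y) refl (S m K) (S m i)) ⟩
    binom K (λ i → S m K * 1ℚ + - S m i)                   ≡⟨ binom-+ K _ _ ⟩
    binom K (λ i → S m K * 1ℚ) + binom K (λ i → - S m i)  ≡⟨ cong₂ _+_ (binom-*ˡ K (S m K) (λ _ → 1ℚ)) (binom-neg K (S m)) ⟩
    S m K * binom K (λ _ → 1ℚ) - binom K (S m)             ≡⟨ cong₂ (λ x y → S m K * x - y) (binom-ones K) (euler-transform m K) ⟩
    S m K * pow2 K - pow2 K * T m K
      ≡⟨ solve 3 (λ s p l → s :* p :- p :* l := p :* (s :- l)) refl (S m K) (pow2 K) (T m K) ⟩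
    pow2 K * (S m K - T m K)                               ∎)
    where open ≡-Reasoning

  ascending : ∀ (f : ℕ → ℚ) {c} → (∀ n → c ℕ.≤ n → f n ≤ f (suc n)) → ∀ {j k} → c ℕ.≤ j → j ℕ.≤ k → f j ≤ f k
  ascending f up {j} {zero}  c≤j j≤0 with ℕP.n≤0⇒n≡0 j≤0
  ... | refl = ≤-refl
  ascending f up {j} {suc k} c≤j j≤k+1 with ℕP.m≤n⇒m<n∨m≡n j≤k+1
  ... | inj₂ refl  = ≤-refl
  ... | inj₁ j<k+1 = ≤-trans (ascending f up c≤j (ℕP.≤-pred j<k+1)) (up k (ℕP.≤-trans c≤j (ℕP.≤-pred j<k+1)))

  descending : ∀ (f : ℕ → ℚ) {c} → (∀ n → c ℕ.≤ n → f (suc n) ≤ f n) → ∀ {j k} → c ℕ.≤ j → j ℕ.≤ k → f k ≤ f j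
  descending f down {j} {zero}  c≤j j≤0 with ℕP.n≤0⇒n≡0 j≤0
  ... | refl = ≤-refl
  descending f down {j} {suc k} c≤j j≤k+1 with ℕP.m≤n⇒m<n∨m≡n j≤k+1
  ... | inj₂ refl  = ≤-refl
  ... | inj₁ j<k+1 = ≤-trans (down k (ℕP.≤-trans c≤j (ℕP.≤-pred j<k+1))) (descending f down c≤j (ℕP.≤-pred j<k+1))

  invPow1-nonneg : ∀ j → 0ℚ ≤ invPow j 1
  invPow1-nonneg zero    = ≤-refl
  invPow1-nonneg (suc j) = *-nonneg (recip-nonneg j) (nonNegative⁻¹ 1ℚ)

  hsum-nonneg : ∀ m n → 0ℚ ≤ hsum m n
  hsum-nonneg zero    n = nonNegative⁻¹ 1ℚ
  hsum-nonneg (suc m) n = Σ₁-nonneg n (λ j _ → *-nonneg (hsum-nonneg m j) (invPow1-nonneg j))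

  hsum-mono : ∀ m {n n′} → n ℕ.≤ n′ → hsum m n ≤ hsum m n′
  hsum-mono m = ascending (hsum m) (λ n _ → grows-by-one m n) ℕ.z≤n
    where
    grows-by-one : ∀ m n → hsum m n ≤ hsum m (suc n)
    grows-by-one zero    n = ≤-refl
    grows-by-one (suc m) n = begin
      hsum (suc m) n                                                  ≡⟨ sym (+-identityʳ (hsum (suc m) n)) ⟩
      hsum (suc m) n + 0ℚ
        ≤⟨ +-monoʳ-≤ (hsum (suc m) n) (*-nonneg (hsum-nonneg m (suc n)) (invPow1-nonneg (suc n))) ⟩
      hsum (suc m) n + hsum m (suc n) * invPow (suc n) 1              ∎
      where open ≤-Reasoning

  hsum-at-1 : ∀ m → hsum m 1 ≡ 1ℚ
  hsum-at-1 zero    = refl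
  hsum-at-1 (suc m) = cong (λ z → 0ℚ + z * invPow 1 1) (hsum-at-1 m)

  hsum-grows : ∀ m n → 1 ℕ.≤ n → hsum m n ≤ hsum (suc m) n
  hsum-grows zero    n 1≤n = ≤-trans (≤-reflexive (sym (hsum-at-1 1))) (hsum-mono 1 1≤n)
  hsum-grows (suc m) n 1≤n = Σ₁-mono n (λ j 1≤j _ → *-monoʳ-≤-nonneg (invPow1-nonneg j) (hsum-grows m j 1≤j))

  hsum-power : ∀ m n → hsum m n ≤ qpow (hsum 1 n) m
  hsum-power zero    n = ≤-refl
  hsum-power (suc m) n = begin
    Σ₁ n (λ j → hsum m j * invPow j 1)
      ≤⟨ Σ₁-mono n (λ j _ j≤n → ≤-trans (*-monoʳ-≤-nonneg (invPow1-nonneg j) (hsum-mono m j≤n))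
                                                                     (≤-reflexive (cong (hsum m n *_) (sym (*-identityˡ (invPow j 1)))))) ⟩
    Σ₁ n (λ j → hsum m n * (1ℚ * invPow j 1))   ≡⟨ Σ₁-*ˡ n (hsum m n) _ ⟩
    hsum m n * hsum 1 n                          ≤⟨ *-monoʳ-≤-nonneg (hsum-nonneg 1 n) (hsum-power m n) ⟩
    qpow (hsum 1 n) m * hsum 1 n                 ≡⟨ *-comm (qpow (hsum 1 n) m) (hsum 1 n) ⟩
    qpow (hsum 1 n) (suc m)                      ∎
    where open ≤-Reasoning

  hsum-ratio : ∀ m n → 1 ℕ.≤ n → toℚ n * hsum m (suc n) ≤ toℚ (suc n) * hsum m n
  hsum-ratio zero    n _   = *-monoʳ-≤-nonneg (nonNegative⁻¹ 1ℚ) (toℚ-mono (ℕP.n≤1+n n))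
  hsum-ratio (suc m) n 1≤n = begin
    toℚ n * (h′ + hsum m (suc n) * c)
      ≡⟨ solve 4 (λ t a b c → t :* (a :+ b :* c) := t :* a :+ (t :* b) :* c) refl (toℚ n) h′ (hsum m (suc n)) c ⟩
    toℚ n * h′ + (toℚ n * hsum m (suc n)) * c
      ≤⟨ +-monoʳ-≤ (toℚ n * h′) (*-monoʳ-≤-nonneg (invPow1-nonneg (suc n)) (hsum-ratio m n 1≤n)) ⟩
    toℚ n * h′ + (toℚ (suc n) * hsum m n) * c    ≡⟨ cong (toℚ n * h′ +_) cancel ⟩
    toℚ n * h′ + hsum m n                        ≤⟨ +-monoʳ-≤ (toℚ n * h′) (hsum-grows m n 1≤n) ⟩
    toℚ n * h′ + h′                              ≡⟨ solve 2 (λ t a → t :* a :+ a := (con 1ℚ :+ t) :* a) refl (toℚ n) h′ ⟩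
    (1ℚ + toℚ n) * h′                            ≡⟨ cong (_* h′) (sym (toℚ-suc n)) ⟩
    toℚ (suc n) * h′                             ∎
    where
    open ≤-Reasoning
    h′ c : ℚ
    h′ = hsum (suc m) n
    c  = invPow (suc n) 1
    cancel : (toℚ (suc n) * hsum m n) * (recip n * 1ℚ) ≡ hsum m n
    cancel = begin-equality
      (toℚ (suc n) * hsum m n) * (recip n * 1ℚ)
        ≡⟨ solve 3 (λ t h r → (t :* h) :* (r :* con 1ℚ) := h :* (t :* r)) refl (toℚ (suc n)) (hsum m n) (recip n) ⟩
      hsum m n * (toℚ (suc n) * recip n)          ≡⟨ trans (cong (hsum m n *_) (recip-inverseʳ n)) (*-identityʳ (hsum m n)) ⟩
      hsum m n                                    ∎

  a-nonneg : ∀ m n → 0ℚ ≤ a m n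
  a-nonneg m n = *-nonneg (toℚ-nonneg (m ℕ.!)) (*-nonneg (hsum-nonneg m n) (invPow1-nonneg n))

  a-at-1 : ∀ m → a m 1 ≡ toℚ (m ℕ.!)
  a-at-1 m = trans (cong (λ z → toℚ (m ℕ.!) * (z * invPow 1 1)) (hsum-at-1 m)) (*-identityʳ (toℚ (m ℕ.!)))

  a-antitone : ∀ m {i j} → 1 ℕ.≤ i → i ℕ.≤ j → a m j ≤ a m i
  a-antitone m = descending (a m) (λ n 1≤n → *-monoˡ-≤-nonneg (toℚ-nonneg (m ℕ.!)) (quotient-step n 1≤n))
    where
    quotient-step : ∀ n → 1 ℕ.≤ n → hsum m (suc n) * invPow (suc n) 1 ≤ hsum m n * invPow n 1
    quotient-step n@(suc p) 1≤n = begin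
      X * (recip n * 1ℚ)                     ≡⟨ solve 2 (λ r x → x :* (r :* con 1ℚ) := con 1ℚ :* (r :* x)) refl (recip n) X ⟩
      1ℚ * (recip n * X)                     ≡⟨ cong (_* (recip n * X)) (sym (recip-inverseˡ p)) ⟩
      (recip p * toℚ n) * (recip n * X)
        ≡⟨ solve 4 (λ rp t rn x → (rp :* t) :* (rn :* x) := (rp :* rn) :* (t :* x)) refl (recip p) (toℚ n) (recip n) X ⟩
      (recip p * recip n) * (toℚ n * X)
        ≤⟨ *-monoˡ-≤-nonneg (*-nonneg (recip-nonneg p) (recip-nonneg n)) (hsum-ratio m n 1≤n) ⟩
      (recip p * recip n) * (toℚ (suc n) * X′)
        ≡⟨ solve 4 (λ rp rn t y → (rp :* rn) :* (t :* y) := (y :* (rp :* con 1ℚ)) :* (rn :* t)) refl (recip p) (recip n) (toℚ (suc n)) X′ ⟩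
      (X′ * (recip p * 1ℚ)) * (recip n * toℚ (suc n))
        ≡⟨ trans (cong ((X′ * (recip p * 1ℚ)) *_) (recip-inverseˡ n)) (*-identityʳ _) ⟩
      X′ * (recip p * 1ℚ)                     ∎
      where
      open ≤-Reasoning
      X X′ : ℚ
      X = hsum m (suc n)
      X′ = hsum m n

  altSign-square : ∀ n → altSign n * altSign n ≡ 1ℚ
  altSign-square zero                = refl
  altSign-square (suc zero)          = refl
  altSign-square (suc (suc n))       = trans (solve 1 (λ s → (s :* (:- con 1ℚ)) :* (s :* (:- con 1ℚ)) := s :* s) refl (altSign (suc n)))
                                             (altSign-square (suc n))

  altSign-abs : ∀ n → ∣ altSign n ∣ ≡ 1ℚ
  altSign-abs zero          = refl
  altSign-abs (suc zero)    = refl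
  altSign-abs (suc (suc n)) = trans (∣p*q∣≡∣p∣*∣q∣ (altSign (suc n)) (- 1ℚ)) (cong (_* 1ℚ) (altSign-abs (suc n)))

  module Leibniz (s b : ℕ → ℚ)
                 (b-nonneg : ∀ n → 0ℚ ≤ b n)
                 (b-step : ∀ n → 1 ℕ.≤ n → b (suc n) ≤ b n)
                 (s-step : ∀ i → s (suc i) ≡ s i + b (suc i) * altSign (suc i)) where

    signed-tail : ∀ d i → (0ℚ ≤ altSign (suc i) * (s (d ℕ.+ i) - s i)) × (altSign (suc i) * (s (d ℕ.+ i) - s i) ≤ b (suc i))
    signed-tail zero    i = ≤-reflexive (sym vanishes) , ≤-trans (≤-reflexive vanishes) (b-nonneg (suc i))
      where
      vanishes : altSign (suc i) * (s i - s i) ≡ 0ℚ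
      vanishes = solve 2 (λ σ x → σ :* (x :- x) := con 0ℚ) refl (altSign (suc i)) (s i)
    signed-tail (suc d) i = ≤-trans lower (≤-reflexive (sym peel))
                          , ≤-trans (≤-reflexive peel) upper
      where
      σ Z : ℚ
      σ = altSign (suc i)
      Z = altSign (suc (suc i)) * (s (d ℕ.+ suc i) - s (suc i))
      peel : σ * (s (suc d ℕ.+ i) - s i) ≡ b (suc i) - Z
      peel = begin
        σ * (s (suc (d ℕ.+ i)) - s i)     ≡⟨ cong (λ k → σ * (s k - s i)) (sym (ℕP.+-suc d i)) ⟩
        σ * (s (d ℕ.+ suc i) - s i)
          ≡⟨ solve 4 (λ σ t x y → σ :* (t :- x) := y :* (σ :* σ) :- (σ :* (:- con 1ℚ)) :* (t :- (x :+ y :* σ))) refl σ (s (d ℕ.+ suc i)) (s i) (b (suc i)) ⟩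
        b (suc i) * (σ * σ) - Z′
          ≡⟨ cong₂ (λ x y → b (suc i) * x - altSign (suc (suc i)) * (s (d ℕ.+ suc i) - y)) (altSign-square (suc i)) (sym (s-step i)) ⟩
        b (suc i) * 1ℚ - Z                ≡⟨ cong (_- Z) (*-identityʳ (b (suc i))) ⟩
        b (suc i) - Z                     ∎
        where
        open ≡-Reasoning
        Z′ : ℚ
        Z′ = (σ * (- 1ℚ)) * (s (d ℕ.+ suc i) - (s i + b (suc i) * σ))
      lower : 0ℚ ≤ b (suc i) - Z
      lower = sub-nonneg (≤-trans (proj₂ (signed-tail d (suc i))) (b-step (suc i) (ℕ.s≤s ℕ.z≤n)))
      upper : b (suc i) - Z ≤ b (suc i)
      upper = sub-≤ (proj₁ (signed-tail d (suc i)))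

    tail : ∀ {i K} → i ℕ.≤ K → ∣ s K - s i ∣ ≤ b (suc i)
    tail {i} {K} i≤K = subst (λ k → ∣ s k - s i ∣ ≤ b (suc i)) (ℕP.m∸n+n≡m i≤K) (begin
      ∣ D ∣                         ≡⟨ sym (*-identityˡ ∣ D ∣) ⟩
      1ℚ * ∣ D ∣                    ≡⟨ cong (_* ∣ D ∣) (sym (altSign-abs (suc i))) ⟩
      ∣ altSign (suc i) ∣ * ∣ D ∣   ≡⟨ sym (∣p*q∣≡∣p∣*∣q∣ (altSign (suc i)) D) ⟩
      ∣ altSign (suc i) * D ∣       ≡⟨ 0≤p⇒∣p∣≡p (proj₁ (signed-tail (K ℕ.∸ i) i)) ⟩
      altSign (suc i) * D           ≤⟨ proj₂ (signed-tail (K ℕ.∸ i) i) ⟩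
      b (suc i)                     ∎)
      where
      open ≤-Reasoning
      D : ℚ
      D = s (K ℕ.∸ i ℕ.+ i) - s i

  S-tail : ∀ m {i K} → i ℕ.≤ K → ∣ S m K - S m i ∣ ≤ a m (suc i)
  S-tail m = Leibniz.tail (S m) (a m) (a-nonneg m) (λ n 1≤n → a-antitone m 1≤n (ℕP.n≤1+n n)) (S-step m)

  -- Euler's transformation turns pointwise bounds on the tails into a bound on the error:
  -- |S_K - T_K| = 2^{-K} |Σ_i C(K,i) (S_K - S_i)|.
  averaged-bound : ∀ m K (bnd : ℕ → ℚ) → (∀ i → i ℕ.≤ K → ∣ S m K - S m i ∣ ≤ bnd i) →
                   ∣ S m K - T m K ∣ ≤ qpow half K * binom K bnd
  averaged-bound m K bnd tails = begin
    ∣ d ∣                                             ≡⟨ sym (*-identityˡ ∣ d ∣) ⟩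
    1ℚ * ∣ d ∣
      ≡⟨ cong (_* ∣ d ∣) (sym (trans (*-comm (qpow half K) (pow2 K)) (pow2-half K))) ⟩
    (qpow half K * pow2 K) * ∣ d ∣                    ≡⟨ *-assoc (qpow half K) (pow2 K) ∣ d ∣ ⟩
    qpow half K * (pow2 K * ∣ d ∣)                    ≡⟨ cong (λ z → qpow half K * (z * ∣ d ∣)) (sym (0≤p⇒∣p∣≡p (pow2-nonneg))) ⟩
    qpow half K * (∣ pow2 K ∣ * ∣ d ∣)                ≡⟨ cong (qpow half K *_) (sym (∣p*q∣≡∣p∣*∣q∣ (pow2 K) d)) ⟩
    qpow half K * ∣ pow2 K * d ∣                      ≡⟨ cong (λ z → qpow half K * ∣ z ∣) (euler-difference m K) ⟩
    qpow half K * ∣ binom K (λ i → S m K - S m i) ∣   ≤⟨ *-monoˡ-≤-nonneg half^K-nonneg (binom-triangle K _) ⟩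
    qpow half K * binom K (λ i → ∣ S m K - S m i ∣)   ≤⟨ *-monoˡ-≤-nonneg half^K-nonneg (binom-mono K tails) ⟩
    qpow half K * binom K bnd                         ∎
    where
    open ≤-Reasoning
    d : ℚ
    d = S m K - T m K
    pow2-nonneg : 0ℚ ≤ pow2 K
    pow2-nonneg = qpow-nonneg K (toℚ-nonneg 2)
    half^K-nonneg : 0ℚ ≤ qpow half K
    half^K-nonneg = qpow-nonneg K (recip-nonneg 1)

  below : ℕ → ℕ → ℚ
  below zero    i       = 0ℚ
  below (suc L) zero    = 1ℚ
  below (suc L) (suc i) = below L i

  below-nonneg : ∀ L i → 0ℚ ≤ below L i
  below-nonneg zero    i       = ≤-refl
  below-nonneg (suc L) zero    = nonNegative⁻¹ 1ℚ
  below-nonneg (suc L) (suc i) = below-nonneg L i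

  below-yes : ∀ L i → i ℕ.< L → below L i ≡ 1ℚ
  below-yes (suc L) zero    _         = refl
  below-yes (suc L) (suc i) (ℕ.s≤s i<L) = below-yes L i i<L

  below-no : ∀ L i → L ℕ.≤ i → below L i ≡ 0ℚ
  below-no zero    i       _           = refl
  below-no (suc L) (suc i) (ℕ.s≤s L≤i) = below-no L i L≤i

  below-mono : ∀ L i → below L i ≤ below (suc L) i
  below-mono zero    zero    = nonNegative⁻¹ 1ℚ
  below-mono zero    (suc i) = ≤-refl
  below-mono (suc L) zero    = ≤-refl
  below-mono (suc L) (suc i) = below-mono L i

  lowsum : ℕ → ℕ → ℚ
  lowsum K L = binom K (below L)

  -- Splitting the tails at L: the first L tails are at most a_1 = m!, the others at most a_{L+1}.
  tail-split : ∀ m L {i K} → i ℕ.≤ K → ∣ S m K - S m i ∣ ≤ a m (suc L) + toℚ (m ℕ.!) * below L i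
  tail-split m L {i} {K} i≤K with i ℕ.<? L
  ... | yes i<L = begin
    ∣ S m K - S m i ∣                           ≤⟨ S-tail m i≤K ⟩
    a m (suc i)                                 ≤⟨ a-antitone m ℕP.≤-refl (ℕ.s≤s ℕ.z≤n) ⟩
    a m 1                                       ≡⟨ trans (a-at-1 m) (sym (+-identityˡ _)) ⟩
    0ℚ + toℚ (m ℕ.!)                            ≤⟨ +-monoˡ-≤ _ (a-nonneg m (suc L)) ⟩
    a m (suc L) + toℚ (m ℕ.!)
      ≡⟨ cong (a m (suc L) +_) (sym (trans (cong (toℚ (m ℕ.!) *_) (below-yes L i i<L)) (*-identityʳ _))) ⟩
    a m (suc L) + toℚ (m ℕ.!) * below L i       ∎
    where open ≤-Reasoning
  ... | no i≮L = begin
    ∣ S m K - S m i ∣                           ≤⟨ S-tail m i≤K ⟩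
    a m (suc i)                                 ≤⟨ a-antitone m (ℕ.s≤s ℕ.z≤n) (ℕ.s≤s (ℕP.≮⇒≥ i≮L)) ⟩
    a m (suc L)                                 ≡⟨ sym (+-identityʳ _) ⟩
    a m (suc L) + 0ℚ
      ≡⟨ cong (a m (suc L) +_) (sym (trans (cong (toℚ (m ℕ.!) *_) (below-no L i (ℕP.≮⇒≥ i≮L))) (*-zeroʳ (toℚ (m ℕ.!))))) ⟩
    a m (suc L) + toℚ (m ℕ.!) * below L i       ∎
    where open ≤-Reasoning

  error-bound : ∀ m K L → ∣ S m K - T m K ∣ ≤ a m (suc L) + toℚ (m ℕ.!) * (lowsum K L * qpow half K)
  error-bound m K L = ≤-trans (averaged-bound m K (λ i → A + M * below L i) (λ i i≤K → tail-split m L i≤K)) (≤-reflexive (begin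
    qpow half K * binom K (λ i → A + M * below L i)
      ≡⟨ cong (qpow half K *_) (binom-+ K (λ _ → A) (λ i → M * below L i)) ⟩
    qpow half K * (binom K (λ _ → A) + binom K (λ i → M * below L i))
      ≡⟨ cong₂ (λ x y → qpow half K * (x + y)) (trans (binom-cong K (λ _ _ → sym (*-identityʳ A))) (binom-*ˡ K A (λ _ → 1ℚ))) (binom-*ˡ K M (below L)) ⟩
    qpow half K * (A * binom K (λ _ → 1ℚ) + M * lowsum K L)
      ≡⟨ cong (λ z → qpow half K * (A * z + M * lowsum K L)) (binom-ones K) ⟩
    qpow half K * (A * pow2 K + M * lowsum K L)
      ≡⟨ solve 5 (λ q a p m l → q :* (a :* p :+ m :* l) := a :* (p :* q) :+ m :* (l :* q)) refl (qpow half K) A (pow2 K) M (lowsum K L) ⟩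
    A * (pow2 K * qpow half K) + M * (lowsum K L * qpow half K)
      ≡⟨ cong (λ z → A * z + M * (lowsum K L * qpow half K)) (pow2-half K) ⟩
    A * 1ℚ + M * (lowsum K L * qpow half K)                  ≡⟨ cong (_+ M * (lowsum K L * qpow half K)) (*-identityʳ A) ⟩
    A + M * (lowsum K L * qpow half K)                       ∎))
    where
    open ≡-Reasoning
    A M : ℚ
    A = a m (suc L)
    M = toℚ (m ℕ.!)

  lowsum-zero : ∀ K → lowsum K 0 ≡ 0ℚ
  lowsum-zero K = trans (binom-*ˡ K 0ℚ (λ _ → 0ℚ)) (*-zeroˡ (binom K (λ _ → 0ℚ)))

  lowsum-pascal : ∀ K L → lowsum (suc K) (suc L) ≡ lowsum K (suc L) + lowsum K L
  lowsum-pascal K L = binom-pascal K (below (suc L))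

  lowsum-poly : ∀ K L → lowsum K L ≤ toℚ (suc K ℕ.^ L)
  lowsum-poly K       zero    = ≤-trans (≤-reflexive (lowsum-zero K)) (toℚ-nonneg 1)
  lowsum-poly zero    (suc L) = ≤-reflexive (trans (*-identityˡ 1ℚ) (cong toℚ (sym (ℕP.^-zeroˡ (suc L)))))
  lowsum-poly (suc K) (suc L) = begin
    lowsum (suc K) (suc L)                                ≡⟨ lowsum-pascal K L ⟩
    lowsum K (suc L) + lowsum K L                         ≤⟨ +-mono-≤ (lowsum-poly K (suc L)) (lowsum-poly K L) ⟩
    toℚ (suc K ℕ.^ suc L) + toℚ (suc K ℕ.^ L)             ≡⟨ sym (toℚ-+ (suc K ℕ.^ suc L) (suc K ℕ.^ L)) ⟩
    toℚ (suc K ℕ.^ suc L ℕ.+ suc K ℕ.^ L)                 ≤⟨ toℚ-mono nat ⟩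
    toℚ (suc (suc K) ℕ.^ suc L)                           ∎
    where
    open ≤-Reasoning
    -- (K+1)^{L+1} + (K+1)^L = (K+2)(K+1)^L ≤ (K+2)^{L+1}
    nat : suc K ℕ.^ suc L ℕ.+ suc K ℕ.^ L ℕ.≤ suc (suc K) ℕ.^ suc L
    nat = ℕP.≤-trans (ℕP.≤-reflexive (ℕP.+-comm (suc K ℕ.^ suc L) (suc K ℕ.^ L)))
                     (ℕP.*-monoʳ-≤ (suc (suc K)) (ℕP.^-monoˡ-≤ L (ℕP.n≤1+n (suc K))))

  -- Σ_{i<L} C(K+1,i) ≤ 2 Σ_{i<L} C(K,i), so 2^{-K} Σ_{i<L} C(K,i) decreases in K.
  lowsum-double : ∀ K L → lowsum (suc K) L ≤ toℚ 2 * lowsum K L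
  lowsum-double K zero    = begin
    lowsum (suc K) 0     ≡⟨ lowsum-zero (suc K) ⟩
    0ℚ                   ≡⟨ sym (trans (cong (toℚ 2 *_) (lowsum-zero K)) (*-zeroʳ (toℚ 2))) ⟩
    toℚ 2 * lowsum K 0   ∎
    where open ≤-Reasoning
  lowsum-double K (suc L) = begin
    lowsum (suc K) (suc L)              ≡⟨ lowsum-pascal K L ⟩
    lowsum K (suc L) + lowsum K L       ≤⟨ +-monoʳ-≤ (lowsum K (suc L)) (binom-mono K (λ i _ → below-mono L i)) ⟩
    lowsum K (suc L) + lowsum K (suc L) ≡⟨ solve 1 (λ x → x :+ x := (con 1ℚ :+ con 1ℚ) :* x) refl (lowsum K (suc L)) ⟩
    (1ℚ + 1ℚ) * lowsum K (suc L)        ≡⟨ cong (_* lowsum K (suc L)) (sym (toℚ-suc 1)) ⟩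
    toℚ 2 * lowsum K (suc L)            ∎
    where open ≤-Reasoning

  lowsum-scaled-antitone : ∀ L {K K′} → K ℕ.≤ K′ → lowsum K′ L * qpow half K′ ≤ lowsum K L * qpow half K
  lowsum-scaled-antitone L = descending (λ K → lowsum K L * qpow half K) (λ K _ → halving K) ℕ.z≤n
    where
    halving : ∀ K → lowsum (suc K) L * qpow half (suc K) ≤ lowsum K L * qpow half K
    halving K = begin
      lowsum (suc K) L * (half * qpow half K)
        ≤⟨ *-monoʳ-≤-nonneg (*-nonneg (recip-nonneg 1) (qpow-nonneg K (recip-nonneg 1))) (lowsum-double K L) ⟩
      (toℚ 2 * lowsum K L) * (half * qpow half K)
        ≡⟨ solve 4 (λ t l h q → (t :* l) :* (h :* q) := (t :* h) :* (l :* q)) refl (toℚ 2) (lowsum K L) half (qpow half K) ⟩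
      (toℚ 2 * half) * (lowsum K L * qpow half K)
        ≡⟨ trans (cong (_* (lowsum K L * qpow half K)) (recip-inverseʳ 1)) (*-identityˡ _) ⟩
      lowsum K L * qpow half K                         ∎
      where open ≤-Reasoning

  harmonic-block : ∀ n d → hsum 1 (n ℕ.+ d) ≤ hsum 1 n + toℚ d * recip n
  harmonic-block n zero    = begin
    hsum 1 (n ℕ.+ 0)            ≡⟨ cong (hsum 1) (ℕP.+-identityʳ n) ⟩
    hsum 1 n                    ≡⟨ sym (+-identityʳ (hsum 1 n)) ⟩
    hsum 1 n + 0ℚ               ≡⟨ cong (hsum 1 n +_) (sym (*-zeroˡ (recip n))) ⟩
    hsum 1 n + toℚ 0 * recip n  ∎
    where open ≤-Reasoning
  harmonic-block n (suc d) = begin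
    hsum 1 (n ℕ.+ suc d)                                   ≡⟨ cong (hsum 1) (ℕP.+-suc n d) ⟩
    hsum 1 (n ℕ.+ d) + 1ℚ * (recip (n ℕ.+ d) * 1ℚ)         ≡⟨ cong (hsum 1 (n ℕ.+ d) +_) (trans (*-identityˡ _) (*-identityʳ _)) ⟩
    hsum 1 (n ℕ.+ d) + recip (n ℕ.+ d)                     ≤⟨ +-mono-≤ (harmonic-block n d) (recip-antitone (ℕP.m≤m+n n d)) ⟩
    (hsum 1 n + toℚ d * recip n) + recip n
      ≡⟨ solve 3 (λ h t r → (h :+ t :* r) :+ r := h :+ (con 1ℚ :+ t) :* r) refl (hsum 1 n) (toℚ d) (recip n) ⟩
    hsum 1 n + (1ℚ + toℚ d) * recip n                      ≡⟨ cong (λ z → hsum 1 n + z * recip n) (sym (toℚ-suc d)) ⟩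
    hsum 1 n + toℚ (suc d) * recip n                       ∎
    where open ≤-Reasoning

  harmonic-double : ∀ n → hsum 1 (n ℕ.+ n) ≤ hsum 1 n + 1ℚ
  harmonic-double n = begin
    hsum 1 (n ℕ.+ n)                  ≤⟨ harmonic-block n n ⟩
    hsum 1 n + toℚ n * recip n        ≤⟨ +-monoʳ-≤ (hsum 1 n) (*-monoʳ-≤-nonneg (recip-nonneg n) (toℚ-mono (ℕP.n≤1+n n))) ⟩
    hsum 1 n + toℚ (suc n) * recip n  ≡⟨ cong (hsum 1 n +_) (recip-inverseʳ n) ⟩
    hsum 1 n + 1ℚ                     ∎
    where open ≤-Reasoning

  harmonic-pow2 : ∀ k → hsum 1 (2 ℕ.^ k) ≤ toℚ (suc k)
  harmonic-pow2 zero    = ≤-refl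
  harmonic-pow2 (suc k) = begin
    hsum 1 (2 ℕ.^ suc k)               ≡⟨ cong (λ z → hsum 1 (2 ℕ.^ k ℕ.+ z)) (ℕP.+-identityʳ (2 ℕ.^ k)) ⟩
    hsum 1 (2 ℕ.^ k ℕ.+ 2 ℕ.^ k)       ≤⟨ harmonic-double (2 ℕ.^ k) ⟩
    hsum 1 (2 ℕ.^ k) + 1ℚ              ≤⟨ +-monoˡ-≤ 1ℚ (harmonic-pow2 k) ⟩
    toℚ (suc k) + 1ℚ                   ≡⟨ trans (+-comm (toℚ (suc k)) 1ℚ) (sym (toℚ-suc (suc k))) ⟩
    toℚ (suc (suc k))                  ∎
    where open ≤-Reasoning

  a-decay : ∀ m k → toℚ (2 ℕ.^ k) * a m (2 ℕ.^ k) ≤ toℚ (m ℕ.! ℕ.* suc k ℕ.^ m)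
  a-decay m k = begin
    toℚ (2 ℕ.^ k) * a m (2 ℕ.^ k)          ≡⟨ times-n (2 ℕ.^ k) (ℕP.m^n>0 2 k) ⟩
    M * hsum m (2 ℕ.^ k)                    ≤⟨ *-monoˡ-≤-nonneg (toℚ-nonneg (m ℕ.!)) (hsum-power m (2 ℕ.^ k)) ⟩
    M * qpow (hsum 1 (2 ℕ.^ k)) m
      ≤⟨ *-monoˡ-≤-nonneg (toℚ-nonneg (m ℕ.!)) (qpow-mono m (hsum-nonneg 1 (2 ℕ.^ k)) (harmonic-pow2 k)) ⟩
    M * qpow (toℚ (suc k)) m                ≡⟨ trans (cong (M *_) (qpow-toℚ (suc k) m)) (sym (toℚ-* (m ℕ.!) (suc k ℕ.^ m))) ⟩
    toℚ (m ℕ.! ℕ.* suc k ℕ.^ m)             ∎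
    where
    open ≤-Reasoning
    M : ℚ
    M = toℚ (m ℕ.!)
    times-n : ∀ n → 0 ℕ.< n → toℚ n * a m n ≡ M * hsum m n
    times-n (suc p) _ = begin-equality
      toℚ (suc p) * (M * (hsum m (suc p) * (recip p * 1ℚ)))
        ≡⟨ solve 4 (λ t f h r → t :* (f :* (h :* (r :* con 1ℚ))) := (f :* h) :* (t :* r)) refl (toℚ (suc p)) M (hsum m (suc p)) (recip p) ⟩
      (M * hsum m (suc p)) * (toℚ (suc p) * recip p)
        ≡⟨ trans (cong ((M * hsum m (suc p)) *_) (recip-inverseʳ p)) (*-identityʳ _) ⟩
      M * hsum m (suc p)                               ∎

  -- Take t = 2d + c + 1 and k + 1 = 2^{2t}; then c·(k+1)^d = c·2^{2td} < 2^{c + 2td} and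
  -- c + 2td ≤ t² < 2^{2t} = k + 1.

  n<2^n : ∀ n → n ℕ.< 2 ℕ.^ n
  n<2^n zero    = ℕ.s≤s ℕ.z≤n
  n<2^n (suc n) = ℕP.≤-trans (ℕP.+-mono-≤ (ℕP.m^n>0 2 n) (n<2^n n))
                             (ℕP.≤-reflexive (cong (2 ℕ.^ n ℕ.+_) (sym (ℕP.+-identityʳ (2 ℕ.^ n)))))

  exp-beats-poly : ∀ c d → ∃[ k ] (c ℕ.* suc k ℕ.^ d ℕ.< 2 ℕ.^ k)
  exp-beats-poly c d = k , (begin-strict
    c ℕ.* suc k ℕ.^ d             ≡⟨ cong (λ z → c ℕ.* z ℕ.^ d) suc-k ⟩
    c ℕ.* (2 ℕ.^ j) ℕ.^ d         ≡⟨ cong (c ℕ.*_) (ℕP.^-*-assoc 2 j d) ⟩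
    c ℕ.* 2 ℕ.^ (j ℕ.* d)         <⟨ ℕP.*-monoˡ-< (2 ℕ.^ (j ℕ.* d)) {{ℕP.m^n≢0 2 (j ℕ.* d)}} (n<2^n c) ⟩
    2 ℕ.^ c ℕ.* 2 ℕ.^ (j ℕ.* d)   ≡⟨ sym (ℕP.^-distribˡ-+-* 2 c (j ℕ.* d)) ⟩
    2 ℕ.^ (c ℕ.+ j ℕ.* d)         ≤⟨ ℕP.^-monoʳ-≤ 2 (ℕP.≤-pred exponent) ⟩
    2 ℕ.^ k                       ∎)
    where
    open ℕP.≤-Reasoning
    module ℕS = ℕSolver.+-*-Solver
    t j k : ℕ
    t = suc (d ℕ.+ d ℕ.+ c)
    j = t ℕ.+ t
    k = ℕ.pred (2 ℕ.^ j)
    suc-k : suc k ≡ 2 ℕ.^ j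
    suc-k = ℕP.suc-pred (2 ℕ.^ j) {{ℕP.m^n≢0 2 j}}
    square : t ℕ.+ (t ℕ.* c ℕ.+ j ℕ.* d) ≡ t ℕ.* t
    square = ℕS.solve 2 (λ d c → let t = ℕS.con 1 ℕS.:+ d ℕS.:+ d ℕS.:+ c in
                           t ℕS.:+ (t ℕS.:* c ℕS.:+ (t ℕS.:+ t) ℕS.:* d) ℕS.:= t ℕS.:* t) refl d c
    exponent : c ℕ.+ j ℕ.* d ℕ.< suc k
    exponent = begin-strict
      c ℕ.+ j ℕ.* d                           ≤⟨ ℕP.+-monoˡ-≤ (j ℕ.* d) (ℕP.m≤n*m c t) ⟩
      t ℕ.* c ℕ.+ j ℕ.* d                     <⟨ ℕP.m<n+m (t ℕ.* c ℕ.+ j ℕ.* d) {t} (ℕ.s≤s ℕ.z≤n) ⟩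
      t ℕ.+ (t ℕ.* c ℕ.+ j ℕ.* d)             ≡⟨ square ⟩
      t ℕ.* t                                 <⟨ ℕP.*-mono-< (n<2^n t) (n<2^n t) ⟩
      2 ℕ.^ t ℕ.* 2 ℕ.^ t                     ≡⟨ sym (ℕP.^-distribˡ-+-* 2 t t) ⟩
      2 ℕ.^ j                                 ≡⟨ sym suc-k ⟩
      suc k                                   ∎

  -- ℚ is archimedean: a positive ε = (p+1)/(d+1) is at least 1/(d+1).
  archimedean : ∀ ε → 0ℚ < ε → ∃[ d ] (1ℚ ≤ toℚ (suc d) * ε)
  archimedean ε@(mkℚ (ℤ.+ suc p) d _) _ = d , (begin
    1ℚ                        ≡⟨ sym (recip-inverseʳ d) ⟩
    toℚ (suc d) * recip d     ≤⟨ *-monoˡ-≤-nonneg (toℚ-nonneg (suc d)) recip≤ε ⟩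
    toℚ (suc d) * ε           ∎)
    where
    open ≤-Reasoning
    recip≤ε : recip d ≤ ε
    recip≤ε = subst (_≤ ε) (sym (recip-normal d)) (*≤* (ℤP.*-monoʳ-≤-nonNeg (ℤ.+ suc d) (ℤ.+≤+ (ℕ.s≤s (ℕ.z≤n {p})))))
  archimedean (mkℚ (ℤ.+ zero)  d _) ε>0 = ⊥-elim (ℤ.Positive.pos (positive ε>0))
  archimedean (mkℚ ℤ.-[1+ n ] d _) ε>0 = ⊥-elim (ℤ.Positive.pos (positive ε>0))

  -- Choosing the cut-off L = 2^k with c·m!·(k+1)^m < 2^k makes c·a_{L+1} < 1.
  cutoff : ∀ m c → ∃[ L ] (toℚ c * a m (suc L) < 1ℚ)
  cutoff m c = L , (begin-strict
    toℚ c * a m (suc L)      ≤⟨ *-monoˡ-≤-nonneg (toℚ-nonneg c) (a-antitone m (ℕP.m^n>0 2 k) (ℕP.n≤1+n L)) ⟩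
    toℚ c * a m L            <⟨ *-cancelʳ-<-nonNeg (toℚ L) {{nonNegative (toℚ-nonneg L)}} scaled ⟩
    1ℚ                       ∎)
    where
    open ≤-Reasoning
    k L : ℕ
    k = proj₁ (exp-beats-poly (c ℕ.* m ℕ.!) m)
    L = 2 ℕ.^ k
    scaled : (toℚ c * a m L) * toℚ L < 1ℚ * toℚ L
    scaled = begin-strict
      (toℚ c * a m L) * toℚ L              ≡⟨ solve 3 (λ c x l → (c :* x) :* l := c :* (l :* x)) refl (toℚ c) (a m L) (toℚ L) ⟩
      toℚ c * (toℚ L * a m L)              ≤⟨ *-monoˡ-≤-nonneg (toℚ-nonneg c) (a-decay m k) ⟩
      toℚ c * toℚ (m ℕ.! ℕ.* suc k ℕ.^ m)  ≡⟨ trans (sym (toℚ-* c _)) (cong toℚ (sym (ℕP.*-assoc c (m ℕ.!) _))) ⟩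
      toℚ (c ℕ.* m ℕ.! ℕ.* suc k ℕ.^ m)    <⟨ toℚ-< (proj₂ (exp-beats-poly (c ℕ.* m ℕ.!) m)) ⟩
      toℚ L                                ≡⟨ sym (*-identityˡ (toℚ L)) ⟩
      1ℚ * toℚ L                           ∎

  late-index : ∀ m c L → ∃[ K₀ ] (∀ K → K₀ ℕ.≤ K → toℚ c * (toℚ (m ℕ.!) * (lowsum K L * qpow half K)) < 1ℚ)
  late-index m c L = K₀ , λ K K₀≤K → begin-strict
    toℚ c * (M * (lowsum K L * qpow half K))
      ≤⟨ *-monoˡ-≤-nonneg (toℚ-nonneg c) (*-monoˡ-≤-nonneg (toℚ-nonneg (m ℕ.!)) (lowsum-scaled-antitone L K₀≤K)) ⟩
    toℚ c * (M * (lowsum K₀ L * qpow half K₀))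
      ≤⟨ *-monoˡ-≤-nonneg (toℚ-nonneg c) (*-monoˡ-≤-nonneg (toℚ-nonneg (m ℕ.!))
           (*-monoʳ-≤-nonneg (qpow-nonneg K₀ (recip-nonneg 1)) (lowsum-poly K₀ L))) ⟩
    toℚ c * (M * (toℚ (suc K₀ ℕ.^ L) * qpow half K₀))
      ≡⟨ solve 4 (λ c f x h → c :* (f :* (x :* h)) := ((c :* f) :* x) :* h) refl (toℚ c) M (toℚ (suc K₀ ℕ.^ L)) (qpow half K₀) ⟩
    ((toℚ c * M) * toℚ (suc K₀ ℕ.^ L)) * qpow half K₀    ≡⟨ cong (_* qpow half K₀) casts ⟩
    toℚ (c ℕ.* m ℕ.! ℕ.* suc K₀ ℕ.^ L) * qpow half K₀
      <⟨ *-monoˡ-<-pos (qpow half K₀) {{positive (qpow-pos K₀ (recip-pos 1))}} (toℚ-< (proj₂ (exp-beats-poly (c ℕ.* m ℕ.!) L))) ⟩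
    toℚ (2 ℕ.^ K₀) * qpow half K₀                        ≡⟨ trans (cong (_* qpow half K₀) (sym (qpow-toℚ 2 K₀))) (pow2-half K₀) ⟩
    1ℚ                                                   ∎
    where
    open ≤-Reasoning
    K₀ : ℕ
    K₀ = proj₁ (exp-beats-poly (c ℕ.* m ℕ.!) L)
    M : ℚ
    M = toℚ (m ℕ.!)
    casts : (toℚ c * M) * toℚ (suc K₀ ℕ.^ L) ≡ toℚ (c ℕ.* m ℕ.! ℕ.* suc K₀ ℕ.^ L)
    casts = sym (trans (toℚ-* (c ℕ.* m ℕ.!) _) (cong (_* toℚ (suc K₀ ℕ.^ L)) (toℚ-* c (m ℕ.!))))

  split-ε : ∀ {x y ε} d → 1ℚ ≤ toℚ (suc d) * ε →
            toℚ (2 ℕ.* suc d) * x < 1ℚ → toℚ (2 ℕ.* suc d) * y < 1ℚ → x + y < ε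
  split-ε {x} {y} {ε} d dε≥1 cx<1 cy<1 = *-cancelˡ-<-nonNeg c {{nonNegative (toℚ-nonneg (2 ℕ.* suc d))}} (begin-strict
    c * (x + y)                   ≡⟨ *-distribˡ-+ c x y ⟩
    c * x + c * y                 <⟨ +-mono-< cx<1 cy<1 ⟩
    1ℚ + 1ℚ                       ≤⟨ +-mono-≤ dε≥1 dε≥1 ⟩
    toℚ (suc d) * ε + toℚ (suc d) * ε
      ≡⟨ solve 2 (λ s e → s :* e :+ s :* e := ((con 1ℚ :+ con 1ℚ) :* s) :* e) refl (toℚ (suc d)) ε ⟩
    ((1ℚ + 1ℚ) * toℚ (suc d)) * ε ≡⟨ cong (_* ε) (trans (cong (_* toℚ (suc d)) (sym (toℚ-suc 1))) (sym (toℚ-* 2 (suc d)))) ⟩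
    c * ε                         ∎)
    where
    open ≤-Reasoning
    c : ℚ
    c = toℚ (2 ℕ.* suc d)

open import Defs
open import Data.Nat using (ℕ; suc; _≤_; _!)
open import Data.Product using (∃-syntax)
open import Data.Rational using (ℚ; 0ℚ; _<_; _-_; _*_; ∣_∣)
import Data.Nat as ℕ
open import Data.Product using (_,_; proj₁; proj₂)
open import Data.Rational.Properties using (≤-<-trans)
open Proof

theorem2p7 : (m : ℕ) → 1 ≤ m → (ε : ℚ) → 0ℚ < ε →
    ∃[ N ] ((K : ℕ) → N ≤ K →
    ∣ lhsPartial m K - toℚ (m !) * liHalfPartial (suc m) K ∣ < ε)
theorem2p7 m _ ε ε>0 = K₀ , close
  where
  -- (d+1)·ε ≥ 1; both error terms are made smaller than 1/c with c = 2(d+1)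
  d c : ℕ
  d = proj₁ (archimedean ε ε>0)
  c = 2 ℕ.* suc d
  -- the cut-off L controls the late tails, K₀ the binomial weight of the first L tails
  L K₀ : ℕ
  L  = proj₁ (cutoff m c)
  K₀ = proj₁ (late-index m c L)
  close : (K : ℕ) → K₀ ≤ K → ∣ S m K - T m K ∣ < ε
  close K K₀≤K = ≤-<-trans (error-bound m K L)
    (split-ε d (proj₂ (archimedean ε ε>0)) (proj₂ (cutoff m c)) (proj₂ (late-index m c L) K K₀≤K))
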